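{- Let $n\ge1$ be an integer and $p$ an odd prime with $p\nmid 3n(3n-2)$. For $x\in\mathbb{F}_p^\times$ let $\alpha=\frac{(-1)^n(3n-2)^{3n-2}}{(3n)^{3n}x}$ and $f_x(y)=y^{3n}-2y^{3n-1}+y^{3n-2}-(-1)^n4\alpha\in\mathbb{F}_p[y]$. Let $$C(n,x)=\sum_{\chi\in\widehat{\mathbb{F}_p^\times}} g(\chi^{3n})\,g(\varphi\overline{\chi})\,g(\overline{\chi})\,g(\overline{\chi}^{3n-2})\,\chi(\alpha).$$ Then $C(n,x)+(p-1)^2g(\varphi)\bigl(1+\varphi(\alpha)\delta(\varphi^n)\bigr)$ equals $0$ if $f_x(y)\equiv0\pmod p$ has no solution modulo $p$, and equals $r\,p\,(p-1)\,g(\varphi)$ if $f_x(y)\equiv 0\pmod p$ has $r$ incongruent solutions modulo $p$.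
   Context: $\widehat{\mathbb{F}_p^\times}$ is the group of multiplicative characters of $\mathbb{F}_p^\times$, each extended to $\mathbb{F}_p$ by $\chi(0)=0$ (also for the trivial character $\varepsilon$); $\overline{\chi}$ is the inverse of $\chi$; $\varphi$ is the quadratic character; $\delta(\chi)=1$ if $\chi=\varepsilon$ and $0$ otherwise. For a fixed primitive $p$-th root of unity $\zeta_p$, the Gauss sum is $g(\chi)=\sum_{x\in\mathbb{F}_p}\chi(x)\zeta_p^x$. -}

module Defs where

open import Level using (Level)
open import Data.Bool using (Bool; true; false; if_then_else_)
open import Data.Nat as ℕ using (ℕ; zero; suc; _∸_; _≡ᵇ_)
import Data.Nat.DivMod as ℕD
open import Data.Nat.Divisibility as ℕDiv using (_∣?_)
open import Data.Integer as ℤ using (ℤ; +_; -_)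
open import Data.List using (List; []; _∷_; upTo; filter; length)
open import Relation.Nullary using (does)
open import Algebra.Bundles using (CommutativeRing)

-- Arithmetic in F_p, with F_p represented by residues in ℕ / ℤ.

-- reduction mod p (p = 0 never occurs: p is prime in the statement)
modℕ : ℕ → ℕ → ℕ
modℕ zero    a = a
modℕ (suc m) a = ℕ._%_ a (suc m)

firstSat : (ℕ → Bool) → List ℕ → ℕ
firstSat t []       = 0
firstSat t (k ∷ ks) = if t k then k else firstSat t ks

dlog : (p g a : ℕ) → ℕ
dlog p g a = firstSat (λ k → modℕ p (g ℕ.^ k) ≡ᵇ modℕ p a) (upTo (p ∸ 1))

countRoots : (p : ℕ) → (ℕ → ℤ) → ℕ
countRoots p f = length (filter (λ y → p ∣? ℤ.∣ f y ∣) (upTo p))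

fpoly : (n α : ℕ) → ℕ → ℤ
fpoly n α y =
  (+ y) ℤ.^ (3 ℕ.* n) ℤ.- (+ 2) ℤ.* (+ y) ℤ.^ (3 ℕ.* n ∸ 1)
  ℤ.+ (+ y) ℤ.^ (3 ℕ.* n ∸ 2) ℤ.- ((- + 1) ℤ.^ n) ℤ.* (+ 4) ℤ.* (+ α)

-- Characters and Gauss sums with values in a commutative ring R,
-- given a primitive root g mod p, a primitive (p-1)-th root of unity ω
-- and a primitive p-th root of unity ζ in R.
-- The characters of F_p^× are χ_j (j = 0,…,p-2), χ_j(g^k) = ω^{jk},
-- χ_j(0) = 0 (also for the trivial character χ_0 = ε).
-- Exponent arithmetic: χ_j χ_k = χ_{j+k}, \bar χ_j = χ_{(p-2) j}
-- (indices mod p-1, which is harmless since ω^{p-1} = 1),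
-- φ = χ_{(p-1)/2}.

module Chars {c ℓ : Level} (R : CommutativeRing c ℓ) (p g : ℕ)
             (ω ζ : CommutativeRing.Carrier R) where
  open CommutativeRing R

  pow : Carrier → ℕ → Carrier
  pow x zero    = 1#
  pow x (suc k) = x * pow x k

  fromℕ : ℕ → Carrier
  fromℕ zero    = 0#
  fromℕ (suc k) = 1# + fromℕ k

  sumTo : ℕ → (ℕ → Carrier) → Carrier
  sumTo zero    f = 0#
  sumTo (suc k) f = sumTo k f + f k

  char : ℕ → ℕ → Carrier
  char j a = if modℕ p a ≡ᵇ 0 then 0# else pow ω (j ℕ.* dlog p g a)

  half : ℕ
  half = (p ∸ 1) ℕD./ 2

  inv : ℕ → ℕ
  inv j = (p ∸ 2) ℕ.* j

  gauss : ℕ → Carrier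
  gauss j = sumTo p (λ x → char j x * pow ζ x)

  δ : ℕ → Carrier
  δ j = if modℕ (p ∸ 1) j ≡ᵇ 0 then 1# else 0#

  C : (n α : ℕ) → Carrier
  C n α = sumTo (p ∸ 1) (λ j →
            gauss (3 ℕ.* n ℕ.* j) * gauss (half ℕ.+ inv j) * gauss (inv j)
            * gauss ((3 ℕ.* n ∸ 2) ℕ.* inv j) * char j α)

  LHS : (n α : ℕ) → Carrier
  LHS n α = C n α + fromℕ ((p ∸ 1) ℕ.* (p ∸ 1)) * gauss half
                    * (1# + char half α * δ (n ℕ.* half))

{-# OPTIONS --safe #-}
module Submission where

-- Expanding the four Gauss sums and summing over the character first (orthogonality)
-- forces the product of the multiplicative arguments to be 1, which eliminates one
-- variable.  Substituting a = d t, b = d β makes the additive character e(d · L t β),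
-- so the sum over d is the twisted Gauss sum φ(L) g(φ).  As φ(β) φ(L) is φ of the
-- quadratic β² + (1 + t) β + t^{3n} α, the sum over β is p [discriminant = 0] - 1
-- minus its β = 0 term, and summing these correction terms over t produces exactly
-- -(p - 1)² g(φ) (1 + φ(α) δ(φⁿ)).  Finally t = -1/y maps the t with vanishing
-- discriminant bijectively onto the roots of f_x.

open import Defs
open import Level using (Level)
open import Data.Nat as ℕ using (ℕ; _∸_; _<_; _≤_)
open import Data.Nat.Base using (zero; suc; s≤s; _≡ᵇ_; NonTrivial)
import Data.Nat.Properties as ℕ
open import Data.Nat.DivMod using (m≡m%n+[m/n]*n; m%n<n; m*n%n≡0; m<n⇒m%n≡m; n%n≡0; [m+kn]%n≡m%n)
open import Data.Nat.Divisibility using (_∣_; _∣?_)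
open import Data.Nat.Primality using (Prime; prime⇒nonTrivial)
open import Data.Integer as ℤ using (+_)
import Data.Integer.Divisibility as ℤDiv
open import Data.Bool.Base using (true; false; T; if_then_else_)
open import Data.List.Base using (_∷_; upTo; applyUpTo; filter; length)
open import Data.Product using (_×_; _,_; proj₁; proj₂)
open import Data.Sum using (_⊎_; inj₁; inj₂)
open import Data.Empty using (⊥-elim)
open import Function using (_∘_)
open import Function.Bundles using (Equivalence)
open import Relation.Nullary using (¬_; Dec; yes; no)
open import Relation.Binary.Core using (_Preserves_⟶_)
open import Relation.Binary.PropositionalEquality as ≡ using (_≡_; _≢_)
open import Algebra.Bundles using (CommutativeRing)

module ModularArithmetic where

  open import Level using (0ℓ)
  open import Data.Nat.Base
  open import Data.Nat.Properties
  open import Data.Nat.DivMod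
  open import Data.Nat.Divisibility using (divides; ∣⇒≤; m%n≡0⇒n∣m; n∣m⇒m%n≡0)
  open import Data.Nat.Primality using (euclidsLemma)
  open import Data.Nat.Solver using (module +-*-Solver)
  open import Data.Bool.Base using (Bool)
  open import Data.Fin.Base using (Fin; toℕ; fromℕ<; punchOut)
  import Data.Fin.Properties as Fin
  open import Data.List.Membership.Propositional using (_∈_)
  open import Data.List.Membership.Propositional.Properties using (∈-upTo⁺; ∈-upTo⁻)
  open import Data.List.Relation.Unary.Any using (here; there)
  open import Data.Product using (∃₂; ∃-syntax)
  open import Relation.Binary.Bundles using (Setoid)
  open import Relation.Binary.Definitions using (Decidable; tri<; tri≈; tri>)
  open import Relation.Binary.PropositionalEquality
  import Relation.Binary.Reasoning.Setoid as SetoidReasoning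
  import Data.Integer.Properties as ℤ
  import Data.Integer.Solver as ℤ-Solver
  import Data.Integer.Divisibility.Signed as ℤ∣ₛ
  open import Function.Bundles using (_⇔_; mk⇔)

  *-%-congˡ : ∀ {n} .{{_ : NonZero n}} m {i j} → i % n ≡ j % n → (m * i) % n ≡ (m * j) % n
  *-%-congˡ {n} m {i} {j} i≡j = begin
    (m * i) % n              ≡⟨ %-distribˡ-* m i n ⟩
    (m % n * (i % n)) % n    ≡⟨ cong (λ r → (m % n * r) % n) i≡j ⟩
    (m % n * (j % n)) % n    ≡⟨ %-distribˡ-* m j n ⟨
    (m * j) % n              ∎
    where open ≡-Reasoning

  *-%-congʳ : ∀ {n} .{{_ : NonZero n}} m {i j} → i % n ≡ j % n → (i * m) % n ≡ (j * m) % n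
  *-%-congʳ {n} m {i} {j} i≡j =
    trans (cong (_% n) (*-comm i m)) (trans (*-%-congˡ m i≡j) (cong (_% n) (*-comm m j)))

  *-^-distrib : ∀ a b e → (a * b) ^ e ≡ a ^ e * b ^ e
  *-^-distrib a b zero    = refl
  *-^-distrib a b (suc e) = trans (cong (a * b *_) (*-^-distrib a b e))
    (solve 4 (λ a b x y → (a :* b) :* (x :* y) := (a :* x) :* (b :* y)) refl a b (a ^ e) (b ^ e))
    where open +-*-Solver

  firstSat-satisfies : ∀ (t : ℕ → Bool) {x xs} → x ∈ xs → T (t x) →
                       T (t (firstSat t xs)) × firstSat t xs ∈ xs
  firstSat-satisfies t {x} {y ∷ ys} x∈ tx with t y in ty
  ... | true = subst T (sym ty) _ , here refl
  ... | false with x∈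
  ...   | here refl  = ⊥-elim (subst T ty tx)
  ...   | there x∈ys with firstSat-satisfies t x∈ys tx
  ...     | sat , ∈ys = sat , there ∈ys

  even-or-odd : ∀ n → ∃[ s ] (n ≡ s + s ⊎ n ≡ suc (s + s))
  even-or-odd zero = 0 , inj₁ refl
  even-or-odd (suc n) with even-or-odd n
  ... | s , inj₁ n≡s+s   = s , inj₂ (cong suc n≡s+s)
  ... | s , inj₂ n≡1+s+s = suc s , inj₁ (cong suc (trans n≡1+s+s (sym (+-suc s s))))

  ∣+a-+b∣≡b∸a : ∀ {a b} → a ≤ b → ℤ.∣ + a ℤ.- + b ∣ ≡ b ∸ a
  ∣+a-+b∣≡b∸a {a} {b} a≤b = trans (cong ℤ.∣_∣ (ℤ.[+m]-[+n]≡m⊖n a b)) (ℤ.∣⊖∣-≤ a≤b)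

  ∣+a-+b∣≡a∸b : ∀ {a b} → b ≤ a → ℤ.∣ + a ℤ.- + b ∣ ≡ a ∸ b
  ∣+a-+b∣≡a∸b {a} {b} b≤a = trans (cong ℤ.∣_∣ (ℤ.[+m]-[+n]≡m⊖n a b)) (trans (ℤ.∣m⊖n∣≡∣n⊖m∣ a b) (ℤ.∣⊖∣-≤ b≤a))

  -- Residues modulo p = q + 1, represented by natural numbers; q represents -1.
  module Residues (q : ℕ) where

    open +-*-Solver

    p : ℕ
    p = suc q

    infix 4 _≋_ _≋?_

    record _≋_ (a b : ℕ) : Set where
      constructor mk≋
      field %-≡ : a % p ≡ b % p
    open _≋_ public

    ≋-refl : ∀ {a} → a ≋ a
    ≋-refl = mk≋ refl

    ≋-sym : ∀ {a b} → a ≋ b → b ≋ a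
    ≋-sym (mk≋ e) = mk≋ (sym e)

    ≋-trans : ∀ {a b c} → a ≋ b → b ≋ c → a ≋ c
    ≋-trans (mk≋ e) (mk≋ f) = mk≋ (trans e f)

    ≋-setoid : Setoid 0ℓ 0ℓ
    ≋-setoid = record
      { Carrier       = ℕ
      ; _≈_           = _≋_
      ; isEquivalence = record { refl = ≋-refl ; sym = ≋-sym ; trans = ≋-trans }
      }

    module ≋-Reasoning = SetoidReasoning ≋-setoid

    ≡⇒≋ : ∀ {a b} → a ≡ b → a ≋ b
    ≡⇒≋ e = mk≋ (cong (_% p) e)

    %p≋ : ∀ a → a % p ≋ a
    %p≋ a = mk≋ (m%n%n≡m%n a p)

    _≋?_ : Decidable _≋_
    a ≋? b with a % p ≟ b % p
    ... | yes e = yes (mk≋ e)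
    ... | no ne = no (λ e → ne (%-≡ e))

    +-≋ : ∀ {a b c d} → a ≋ b → c ≋ d → a + c ≋ b + d
    +-≋ {a} {b} {c} {d} (mk≋ e) (mk≋ f) = mk≋ (begin
      (a + c) % p           ≡⟨ %-distribˡ-+ a c p ⟩
      (a % p + c % p) % p   ≡⟨ cong₂ (λ x y → (x + y) % p) e f ⟩
      (b % p + d % p) % p   ≡⟨ %-distribˡ-+ b d p ⟨
      (b + d) % p           ∎)
      where open ≡-Reasoning

    *-≋ : ∀ {a b c d} → a ≋ b → c ≋ d → a * c ≋ b * d
    *-≋ {a} {b} {c} {d} (mk≋ e) (mk≋ f) = mk≋ (begin
      (a * c) % p             ≡⟨ %-distribˡ-* a c p ⟩
      (a % p * (c % p)) % p   ≡⟨ cong₂ (λ x y → (x * y) % p) e f ⟩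
      (b % p * (d % p)) % p   ≡⟨ %-distribˡ-* b d p ⟨
      (b * d) % p             ∎)
      where open ≡-Reasoning

    ^-≋ : ∀ {a b} e → a ≋ b → a ^ e ≋ b ^ e
    ^-≋ zero    _   = ≋-refl
    ^-≋ (suc e) a≋b = *-≋ a≋b (^-≋ e a≋b)

    +-≋ˡ : ∀ a {c d} → c ≋ d → a + c ≋ a + d
    +-≋ˡ a = +-≋ (≋-refl {a})

    +-≋ʳ : ∀ {a b} c → a ≋ b → a + c ≋ b + c
    +-≋ʳ c a≋b = +-≋ a≋b (≋-refl {c})

    *-≋ˡ : ∀ a {c d} → c ≋ d → a * c ≋ a * d
    *-≋ˡ a = *-≋ (≋-refl {a})

    *-≋ʳ : ∀ {a b} c → a ≋ b → a * c ≋ b * c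
    *-≋ʳ c a≋b = *-≋ a≋b (≋-refl {c})

    a+p*b≋a : ∀ a b → a + p * b ≋ a
    a+p*b≋a a b = mk≋ (trans (cong (λ x → (a + x) % p) (*-comm p b)) ([m+kn]%n≡m%n a b p))

    a+q*a≋0 : ∀ a → a + q * a ≋ 0
    a+q*a≋0 a = a+p*b≋a 0 a

    ≋⇒+q*≋0 : ∀ {a b} → a ≋ b → a + q * b ≋ 0
    ≋⇒+q*≋0 {a} {b} a≋b = ≋-trans (+-≋ʳ (q * b) a≋b) (a+q*a≋0 b)

    +q*≋0⇒≋ : ∀ {a b} → a + q * b ≋ 0 → a ≋ b
    +q*≋0⇒≋ {a} {b} a-b≋0 = begin
      a                   ≈⟨ a+p*b≋a a b ⟨
      a + (1 + q) * b     ≡⟨ solve 3 (λ a b q → a :+ (con 1 :+ q) :* b := b :+ (a :+ q :* b)) refl a b q ⟩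
      b + (a + q * b)     ≈⟨ +-≋ˡ b a-b≋0 ⟩
      b + 0               ≡⟨ +-identityʳ b ⟩
      b                   ∎
      where open ≋-Reasoning

    q*q≋1 : q * q ≋ 1
    q*q≋1 = begin
      q * q               ≈⟨ a+p*b≋a (q * q) 1 ⟨
      q * q + (1 + q) * 1 ≡⟨ solve 1 (λ q → q :* q :+ (con 1 :+ q) :* con 1 := con 1 :+ (con 1 :+ q) :* q) refl q ⟩
      1 + p * q           ≈⟨ a+p*b≋a 1 q ⟩
      1                   ∎
      where open ≋-Reasoning

    q*[q*a]≋a : ∀ a → q * (q * a) ≋ a
    q*[q*a]≋a a = ≋-trans (≡⇒≋ (sym (*-assoc q q a))) (≋-trans (*-≋ʳ a q*q≋1) (≡⇒≋ (*-identityˡ a)))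

    [q*a]*[q*a]≋a*a : ∀ a → q * a * (q * a) ≋ a * a
    [q*a]*[q*a]≋a*a a = begin
      q * a * (q * a)    ≡⟨ solve 2 (λ a q → q :* a :* (q :* a) := q :* (q :* (a :* a))) refl a q ⟩
      q * (q * (a * a))  ≈⟨ q*[q*a]≋a (a * a) ⟩
      a * a              ∎
      where open ≋-Reasoning

    completing-square : ∀ B A β → 4 * (β * β + B * β + A) ≋ (2 * β + B) * (2 * β + B) + q * (B * B + q * (4 * A))
    completing-square B A β = ≋-sym (begin
      (2 * β + B) * (2 * β + B) + q * (B * B + q * (4 * A))
        ≡⟨ solve 4 (λ B A β q → (con 2 :* β :+ B) :* (con 2 :* β :+ B) :+ q :* (B :* B :+ q :* (con 4 :* A))
                              := (con 4 :* (β :* β :+ B :* β) :+ q :* (q :* (con 4 :* A))) :+ (con 1 :+ q) :* (B :* B)) refl B A β q ⟩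
      (4 * (β * β + B * β) + q * (q * (4 * A))) + p * (B * B)
        ≈⟨ a+p*b≋a _ (B * B) ⟩
      4 * (β * β + B * β) + q * (q * (4 * A))
        ≈⟨ +-≋ˡ (4 * (β * β + B * β)) (q*[q*a]≋a (4 * A)) ⟩
      4 * (β * β + B * β) + 4 * A
        ≡⟨ solve 3 (λ B A β → con 4 :* (β :* β :+ B :* β) :+ con 4 :* A := con 4 :* (β :* β :+ B :* β :+ A)) refl B A β ⟩
      4 * (β * β + B * β + A)
        ∎)
      where open ≋-Reasoning

    ≋0⇒∣ : ∀ {a} → a ≋ 0 → p ∣ a
    ≋0⇒∣ {a} a≋0 = m%n≡0⇒n∣m a p (%-≡ a≋0)

    ∣⇒≋0 : ∀ {a} → p ∣ a → a ≋ 0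
    ∣⇒≋0 {a} p∣a = mk≋ (n∣m⇒m%n≡0 a p p∣a)

    ≋⇒∣∸ : ∀ {a b} → a ≤ b → a ≋ b → p ∣ b ∸ a
    ≋⇒∣∸ {a} {b} a≤b (mk≋ e) = divides (b / p ∸ a / p) (begin
      b ∸ a                                      ≡⟨ cong₂ _∸_ (m≡m%n+[m/n]*n b p) (m≡m%n+[m/n]*n a p) ⟩
      (b % p + b / p * p) ∸ (a % p + a / p * p)  ≡⟨ cong (λ x → (b % p + b / p * p) ∸ (x + a / p * p)) e ⟩
      (b % p + b / p * p) ∸ (b % p + a / p * p)  ≡⟨ [m+n]∸[m+o]≡n∸o (b % p) _ _ ⟩
      b / p * p ∸ a / p * p                      ≡⟨ *-distribʳ-∸ p (b / p) (a / p) ⟨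
      (b / p ∸ a / p) * p                        ∎)
      where open ≡-Reasoning

    ∣∸⇒≋ : ∀ {a b} → a ≤ b → p ∣ b ∸ a → a ≋ b
    ∣∸⇒≋ {a} {b} a≤b p∣b∸a = mk≋ (sym (trans (cong (_% p) (sym (m+[n∸m]≡n a≤b))) (%-remove-+ʳ a p∣b∸a)))

    suc-≉0 : ∀ {x} → suc x < p → ¬ suc x ≋ 0
    suc-≉0 x<p (mk≋ e) with trans (sym (m<n⇒m%n≡m x<p)) e
    ... | ()

    ∣+a-+b∣⇒≋ : ∀ {a b} → p ∣ ℤ.∣ + a ℤ.- + b ∣ → a ≋ b
    ∣+a-+b∣⇒≋ {a} {b} p∣ with ≤-total a b
    ... | inj₁ a≤b = ∣∸⇒≋ a≤b (subst (p ∣_) (∣+a-+b∣≡b∸a a≤b) p∣)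
    ... | inj₂ b≤a = ≋-sym (∣∸⇒≋ b≤a (subst (p ∣_) (∣+a-+b∣≡a∸b b≤a) p∣))

    ≋⇒∣+a-+b∣ : ∀ {a b} → a ≋ b → p ∣ ℤ.∣ + a ℤ.- + b ∣
    ≋⇒∣+a-+b∣ {a} {b} a≋b with ≤-total a b
    ... | inj₁ a≤b = subst (p ∣_) (sym (∣+a-+b∣≡b∸a a≤b)) (≋⇒∣∸ a≤b a≋b)
    ... | inj₂ b≤a = subst (p ∣_) (sym (∣+a-+b∣≡a∸b b≤a)) (≋⇒∣∸ b≤a (≋-sym a≋b))

  -- Residues modulo a prime p = k + 2, so that a unit a has inverse a ^ k.
  module PrimeResidues (k : ℕ) (prime : Prime (suc (suc k))) where

    open Residues (suc k) public
    open +-*-Solver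

    q : ℕ
    q = suc k

    *≋0⇒ : ∀ {a b} → a * b ≋ 0 → a ≋ 0 ⊎ b ≋ 0
    *≋0⇒ {a} {b} ab≋0 with euclidsLemma a b prime (≋0⇒∣ ab≋0)
    ... | inj₁ p∣a = inj₁ (∣⇒≋0 p∣a)
    ... | inj₂ p∣b = inj₂ (∣⇒≋0 p∣b)

    *-≉0 : ∀ {a b} → ¬ a ≋ 0 → ¬ b ≋ 0 → ¬ a * b ≋ 0
    *-≉0 a≉0 b≉0 ab≋0 with *≋0⇒ ab≋0
    ... | inj₁ a≋0 = a≉0 a≋0
    ... | inj₂ b≋0 = b≉0 b≋0

    ^-≉0 : ∀ {a} e → ¬ a ≋ 0 → ¬ a ^ e ≋ 0
    ^-≉0 zero    _   ()
    ^-≉0 (suc e) a≉0 = *-≉0 a≉0 (^-≉0 e a≉0)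

    *-≋0ˡ : ∀ {a} b → a ≋ 0 → a * b ≋ 0
    *-≋0ˡ b a≋0 = *-≋ʳ b a≋0

    *-≋0ʳ : ∀ a {b} → b ≋ 0 → a * b ≋ 0
    *-≋0ʳ a {b} b≋0 = ≋-trans (≡⇒≋ (*-comm a b)) (*-≋0ˡ a b≋0)

    ^-≋0 : ∀ {a} e → e ≢ 0 → a ≋ 0 → a ^ e ≋ 0
    ^-≋0 zero    e≢0 _   = ⊥-elim (e≢0 refl)
    ^-≋0 (suc e) _   a≋0 = *-≋0ˡ _ a≋0

    1≉0 : ¬ 1 ≋ 0
    1≉0 ()

    q≉0 : ¬ q ≋ 0
    q≉0 q≋0 = 1≉0 (≋-trans (≋-sym q*q≋1) (*-≋0ˡ q q≋0))

    *≋0-cancelˡ : ∀ {v b} → ¬ v ≋ 0 → v * b ≋ 0 → b ≋ 0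
    *≋0-cancelˡ v≉0 vb≋0 with *≋0⇒ vb≋0
    ... | inj₁ v≋0 = ⊥-elim (v≉0 v≋0)
    ... | inj₂ b≋0 = b≋0

    unit-multiples-≋0 : ∀ {u v a b} → ¬ u ≋ 0 → ¬ v ≋ 0 → u * a ≋ v * b → a ≋ 0 ⇔ b ≋ 0
    unit-multiples-≋0 {u} {v} u≉0 v≉0 ua≋vb = mk⇔
      (λ a≋0 → *≋0-cancelˡ v≉0 (≋-trans (≋-sym ua≋vb) (*-≋0ʳ u a≋0)))
      (λ b≋0 → *≋0-cancelˡ u≉0 (≋-trans ua≋vb (*-≋0ʳ v b≋0)))

    *-cancelˡ-≋ : ∀ {c a b} → ¬ c ≋ 0 → c * a ≋ c * b → a ≋ b
    *-cancelˡ-≋ {c} {a} {b} c≉0 ca≋cb with *≋0⇒ c[a-b]≋0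
      where
      open ≋-Reasoning
      c[a-b]≋0 : c * (a + q * b) ≋ 0
      c[a-b]≋0 = begin
        c * (a + q * b)       ≡⟨ solve 4 (λ c a b q → c :* (a :+ q :* b) := c :* a :+ q :* (c :* b)) refl c a b q ⟩
        c * a + q * (c * b)   ≈⟨ ≋⇒+q*≋0 ca≋cb ⟩
        0                       ∎
    ... | inj₁ c≋0   = ⊥-elim (c≉0 c≋0)
    ... | inj₂ a-b≋0 = +q*≋0⇒≋ a-b≋0

    -- α is a unit: otherwise the defining congruence forces p ∣ (3n - 2)^(3n - 2).
    congruence⇒p∤α : ∀ n x α → ¬ p ∣ (3 * n) * (3 * n ∸ 2) →
      (+ p) ℤDiv.∣ (+ (α * (3 * n) ^ (3 * n) * x) ℤ.- (ℤ.- + 1) ℤ.^ n ℤ.* + ((3 * n ∸ 2) ^ (3 * n ∸ 2))) →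
      ¬ p ∣ α
    congruence⇒p∤α n x α p∤3n[3n-2] p∣A-SB p∣α = p∤3n[3n-2] (≋0⇒∣ (*-≋0ʳ (3 * n) 3n-2≋0))
      where
      A = α * (3 * n) ^ (3 * n) * x
      B = (3 * n ∸ 2) ^ (3 * n ∸ 2)
      S = (ℤ.- + 1) ℤ.^ n
      p∣A : p ∣ A
      p∣A = ≋0⇒∣ (*-≋0ˡ x (*-≋0ˡ ((3 * n) ^ (3 * n)) (∣⇒≋0 p∣α)))
      p∣SB : (+ p) ℤ∣ₛ.∣ (S ℤ.* + B)
      p∣SB = subst ((+ p) ℤ∣ₛ.∣_) (ℤS.solve 2 (λ a b → a ℤS.:- (a ℤS.:- b) ℤS.:= b) refl (+ A) (S ℤ.* + B))
               (ℤ∣ₛ.∣m∣n⇒∣m-n (ℤ∣ₛ.∣ᵤ⇒∣ {+ p} {+ A} p∣A) (ℤ∣ₛ.∣ᵤ⇒∣ {+ p} {+ A ℤ.- S ℤ.* + B} p∣A-SB))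
        where module ℤS = ℤ-Solver.+-*-Solver
      ∣S∣≡1 : ∀ e → ℤ.∣ (ℤ.- + 1) ℤ.^ e ∣ ≡ 1
      ∣S∣≡1 zero    = refl
      ∣S∣≡1 (suc e) = trans (ℤ.abs-* (ℤ.- + 1) ((ℤ.- + 1) ℤ.^ e)) (trans (cong (1 *_) (∣S∣≡1 e)) refl)
      B≋0 : B ≋ 0
      B≋0 = ∣⇒≋0 (subst (p ∣_) (trans (ℤ.abs-* S (+ B)) (trans (cong (_* B) (∣S∣≡1 n)) (*-identityˡ B))) (ℤ∣ₛ.∣⇒∣ᵤ p∣SB))
      3n-2≋0 : 3 * n ∸ 2 ≋ 0
      3n-2≋0 with 3 * n ∸ 2 ≋? 0
      ... | yes 3n-2≋0 = 3n-2≋0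
      ... | no 3n-2≉0  = ⊥-elim (^-≉0 (3 * n ∸ 2) 3n-2≉0 B≋0)

  module PrimitiveRoot (k : ℕ) (prime : Prime (suc (suc k))) (g : ℕ)
                       (p∤g : ¬ suc (suc k) ∣ g)
                       (g-primitive : ∀ i → 0 < i → i < suc k → ¬ suc (suc k) ∣ g ^ i ∸ 1) where

    open PrimeResidues k prime public
    open +-*-Solver
    open ≋-Reasoning

    g≉0 : ¬ g ≋ 0
    g≉0 g≋0 = p∤g (≋0⇒∣ g≋0)

    g^≉1 : ∀ i → 0 < i → i < q → ¬ g ^ i ≋ 1
    g^≉1 i 0<i i<q g^i≋1 = g-primitive i 0<i i<q (≋⇒∣∸ 0<g^i (≋-sym g^i≋1))
      where
      0<g^i : 0 < g ^ i
      0<g^i = n≢0⇒n>0 (λ g^i≡0 → ^-≉0 i g≉0 (≡⇒≋ g^i≡0))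

    g^-cancel : ∀ {i j} → i ≤ j → g ^ i ≋ g ^ j → g ^ (j ∸ i) ≋ 1
    g^-cancel {i} {j} i≤j g^i≋g^j = *-cancelˡ-≋ (^-≉0 i g≉0) (begin
      g ^ i * g ^ (j ∸ i)  ≡⟨ ^-distribˡ-+-* g i (j ∸ i) ⟨
      g ^ (i + (j ∸ i))    ≡⟨ cong (g ^_) (m+[n∸m]≡n i≤j) ⟩
      g ^ j                ≈⟨ g^i≋g^j ⟨
      g ^ i                ≡⟨ *-identityʳ (g ^ i) ⟨
      g ^ i * 1            ∎)

    g^-distinct : ∀ {i j} → i < j → j < q → ¬ g ^ i ≋ g ^ j
    g^-distinct {i} {j} i<j j<q g^i≋g^j =
      g^≉1 (j ∸ i) (m<n⇒0<n∸m i<j) (≤-<-trans (m∸n≤m j i) j<q) (g^-cancel (<⇒≤ i<j) g^i≋g^j)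

    residue : ℕ → Fin p
    residue a = fromℕ< (m%n<n a p)

    residue-injective : ∀ {a b} → residue a ≡ residue b → a ≋ b
    residue-injective {a} {b} e =
      mk≋ (trans (sym (Fin.toℕ-fromℕ< (m%n<n a p))) (trans (cong toℕ e) (Fin.toℕ-fromℕ< (m%n<n b p))))

    -- If a unit a were not a power of g, the q distinct residues of g ^ j (j < q)
    -- would avoid both 0 and a, i.e. fit into q - 1 slots.
    g^-surjective : ∀ {a} → ¬ a ≋ 0 → ∃[ j ] j < q × g ^ j ≋ a
    g^-surjective {a} a≉0 with Fin.any? (λ (j : Fin q) → g ^ toℕ j ≋? a)
    ... | yes (j , g^j≋a) = toℕ j , Fin.toℕ<n j , g^j≋a
    ... | no ∄j = ⊥-elim (collision (Fin.pigeonhole (n<1+n k) squeeze))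
      where
      a≢g^ : ∀ j → residue a ≢ residue (g ^ toℕ j)
      a≢g^ j e = ∄j (j , ≋-sym (residue-injective e))
      a≢0 : residue a ≢ residue 0
      a≢0 e = a≉0 (residue-injective e)
      0≢g^ : ∀ j → punchOut a≢0 ≢ punchOut (a≢g^ j)
      0≢g^ j e = ^-≉0 (toℕ j) g≉0 (≋-sym (residue-injective (Fin.punchOut-injective a≢0 (a≢g^ j) e)))
      squeeze : Fin q → Fin k
      squeeze j = punchOut (0≢g^ j)
      collision : ¬ ∃₂ λ i j → toℕ i < toℕ j × squeeze i ≡ squeeze j
      collision (i , j , i<j , e) = g^-distinct i<j (Fin.toℕ<n j) (residue-injective
        (Fin.punchOut-injective (a≢g^ i) (a≢g^ j) (Fin.punchOut-injective (0≢g^ i) (0≢g^ j) e)))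

    log : ℕ → ℕ
    log = dlog p g

    log-spec : ∀ {a} → ¬ a ≋ 0 → log a < q × g ^ log a ≋ a
    log-spec {a} a≉0 with g^-surjective a≉0
    ... | j , j<q , g^j≋a with firstSat-satisfies (λ i → (g ^ i) % p ≡ᵇ a % p) (∈-upTo⁺ j<q)
                                                    (≡⇒≡ᵇ _ _ (%-≡ g^j≋a))
    ...   | sat , ∈ = ∈-upTo⁻ ∈ , mk≋ (≡ᵇ⇒≡ _ _ sat)

    g^log : ∀ {a} → ¬ a ≋ 0 → g ^ log a ≋ a
    g^log a≉0 = proj₂ (log-spec a≉0)

    g^q≋1 : g ^ q ≋ 1
    g^q≋1 with g^-surjective (^-≉0 q g≉0)
    ... | zero  , _   , 1≋g^q       = ≋-sym 1≋g^q
    ... | suc j , j<q , g^[1+j]≋g^q =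
      ⊥-elim (g^≉1 (q ∸ suc j) (m<n⇒0<n∸m j<q) (∸-monoʳ-< z<s (<⇒≤ j<q)) (g^-cancel (<⇒≤ j<q) g^[1+j]≋g^q))

    g^%q : ∀ a → g ^ a ≋ g ^ (a % q)
    g^%q a = begin
      g ^ a                          ≡⟨ cong (g ^_) (m≡m%n+[m/n]*n a q) ⟩
      g ^ (a % q + a / q * q)        ≡⟨ ^-distribˡ-+-* g (a % q) (a / q * q) ⟩
      g ^ (a % q) * g ^ (a / q * q)  ≡⟨ cong (λ x → g ^ (a % q) * g ^ x) (*-comm (a / q) q) ⟩
      g ^ (a % q) * g ^ (q * (a / q)) ≡⟨ cong (g ^ (a % q) *_) (^-*-assoc g q (a / q)) ⟨
      g ^ (a % q) * (g ^ q) ^ (a / q) ≈⟨ *-≋ˡ (g ^ (a % q)) (^-≋ (a / q) g^q≋1) ⟩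
      g ^ (a % q) * 1 ^ (a / q)      ≡⟨ cong (λ x → g ^ (a % q) * x) (^-zeroˡ (a / q)) ⟩
      g ^ (a % q) * 1                ≡⟨ *-identityʳ _ ⟩
      g ^ (a % q)                    ∎

    g^-injective : ∀ a b → g ^ a ≋ g ^ b → a % q ≡ b % q
    g^-injective a b g^a≋g^b with <-cmp (a % q) (b % q)
    ... | tri< a<b _ _ = ⊥-elim (g^-distinct a<b (m%n<n b q) (≋-trans (≋-sym (g^%q a)) (≋-trans g^a≋g^b (g^%q b))))
    ... | tri≈ _ a≡b _ = a≡b
    ... | tri> _ _ b<a = ⊥-elim (g^-distinct b<a (m%n<n a q) (≋-trans (≋-sym (g^%q b)) (≋-trans (≋-sym g^a≋g^b) (g^%q a))))

    g^-cong : ∀ a b → a % q ≡ b % q → g ^ a ≋ g ^ b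
    g^-cong a b a≡b = ≋-trans (g^%q a) (≋-trans (≡⇒≋ (cong (g ^_) a≡b)) (≋-sym (g^%q b)))

    log-* : ∀ {a b} → ¬ a ≋ 0 → ¬ b ≋ 0 → log (a * b) % q ≡ (log a + log b) % q
    log-* {a} {b} a≉0 b≉0 = g^-injective (log (a * b)) (log a + log b) (begin
      g ^ log (a * b)          ≈⟨ g^log (*-≉0 a≉0 b≉0) ⟩
      a * b                    ≈⟨ *-≋ (g^log a≉0) (g^log b≉0) ⟨
      g ^ log a * g ^ log b    ≡⟨ ^-distribˡ-+-* g (log a) (log b) ⟨
      g ^ (log a + log b)      ∎)

    log-^ : ∀ {a} → ¬ a ≋ 0 → ∀ e → log (a ^ e) % q ≡ (e * log a) % q
    log-^ {a} a≉0 e = g^-injective (log (a ^ e)) (e * log a) (begin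
      g ^ log (a ^ e)     ≈⟨ g^log (^-≉0 e a≉0) ⟩
      a ^ e               ≈⟨ ^-≋ e (g^log a≉0) ⟨
      (g ^ log a) ^ e     ≡⟨ ^-*-assoc g (log a) e ⟩
      g ^ (log a * e)     ≡⟨ cong (g ^_) (*-comm (log a) e) ⟩
      g ^ (e * log a)     ∎)

    log-1 : log 1 % q ≡ 0
    log-1 = g^-injective (log 1) 0 (g^log 1≉0)

    log-g : log g % q ≡ 1 % q
    log-g = g^-injective (log g) 1 (≋-trans (g^log g≉0) (≡⇒≋ (sym (*-identityʳ g))))

    fermat : ∀ {a} → ¬ a ≋ 0 → a ^ q ≋ 1
    fermat {a} a≉0 = begin
      a ^ q              ≈⟨ ^-≋ q (g^log a≉0) ⟨
      (g ^ log a) ^ q    ≡⟨ ^-*-assoc g (log a) q ⟩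
      g ^ (log a * q)    ≈⟨ g^-cong (log a * q) 0 (m*n%n≡0 (log a) q) ⟩
      1                  ∎

    a^k*a≋1 : ∀ {a} → ¬ a ≋ 0 → a ^ k * a ≋ 1
    a^k*a≋1 {a} a≉0 = ≋-trans (≡⇒≋ (*-comm (a ^ k) a)) (fermat a≉0)

    a^k*b*a≋b : ∀ {a} → ¬ a ≋ 0 → ∀ b → a ^ k * b * a ≋ b
    a^k*b*a≋b {a} a≉0 b = begin
      a ^ k * b * a      ≡⟨ solve 3 (λ x b a → x :* b :* a := (x :* a) :* b) refl (a ^ k) b a ⟩
      (a ^ k * a) * b    ≈⟨ *-≋ʳ b (a^k*a≋1 a≉0) ⟩
      1 * b              ≡⟨ *-identityˡ b ⟩
      b                  ∎

    z[z+c]≋z²[c*z^k+1] : ∀ {z} c → ¬ z ≋ 0 → z * (z + c) ≋ (z * z) * (c * z ^ k + 1)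
    z[z+c]≋z²[c*z^k+1] {z} c z≉0 = ≋-sym (begin
      (z * z) * (c * z ^ k + 1)        ≡⟨ solve 3 (λ z zk c → (z :* z) :* (c :* zk :+ con 1) := z :* z :+ (z :* zk) :* (z :* c)) refl z (z ^ k) c ⟩
      z * z + (z * z ^ k) * (z * c)    ≈⟨ +-≋ˡ (z * z) (*-≋ʳ (z * c) (fermat z≉0)) ⟩
      z * z + 1 * (z * c)              ≡⟨ solve 2 (λ z c → z :* z :+ con 1 :* (z :* c) := z :* (z :+ c)) refl z c ⟩
      z * (z + c)                      ∎)

    affine : ℕ → ℕ → ℕ → ℕ
    affine c b x = c * x + b

    affine⁻¹ : ℕ → ℕ → ℕ → ℕ
    affine⁻¹ c b y = c ^ k * (y + q * b)

    affine-inverseˡ : ∀ {c} b → ¬ c ≋ 0 → ∀ y → affine c b (affine⁻¹ c b y) ≋ y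
    affine-inverseˡ {c} b c≉0 y = begin
      c * (c ^ k * (y + q * b)) + b  ≡⟨ solve 5 (λ c ck y q b → c :* (ck :* (y :+ q :* b)) :+ b := (c :* ck) :* (y :+ q :* b) :+ b) refl c (c ^ k) y q b ⟩
      (c * c ^ k) * (y + q * b) + b  ≈⟨ +-≋ʳ b (*-≋ʳ (y + q * b) (fermat c≉0)) ⟩
      1 * (y + q * b) + b            ≡⟨ solve 3 (λ y q b → con 1 :* (y :+ q :* b) :+ b := y :+ (con 1 :+ q) :* b) refl y q b ⟩
      y + p * b                      ≈⟨ a+p*b≋a y b ⟩
      y                              ∎

    affine-inverseʳ : ∀ {c} b → ¬ c ≋ 0 → ∀ x → affine⁻¹ c b (affine c b x) ≋ x
    affine-inverseʳ {c} b c≉0 x = begin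
      c ^ k * (c * x + b + q * b)         ≡⟨ solve 5 (λ c ck x q b → ck :* (c :* x :+ b :+ q :* b) := (ck :* c) :* x :+ (con 1 :+ q) :* (ck :* b)) refl c (c ^ k) x q b ⟩
      (c ^ k * c) * x + p * (c ^ k * b)   ≈⟨ a+p*b≋a _ (c ^ k * b) ⟩
      (c ^ k * c) * x                     ≈⟨ *-≋ʳ x (a^k*a≋1 c≉0) ⟩
      1 * x                               ≡⟨ *-identityˡ x ⟩
      x                                   ∎

  module OddPrimitiveRoot (k : ℕ) (prime : Prime (suc (suc k))) (odd : ¬ 2 ∣ suc (suc k)) (g : ℕ)
                          (p∤g : ¬ suc (suc k) ∣ g)
                          (g-primitive : ∀ i → 0 < i → i < suc k → ¬ suc (suc k) ∣ g ^ i ∸ 1) where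

    open PrimitiveRoot k prime g p∤g g-primitive public
    open +-*-Solver
    open ≋-Reasoning

    k≢0 : k ≢ 0
    k≢0 refl = odd (divides 1 refl)

    2≉0 : ¬ 2 ≋ 0
    2≉0 2≋0 = k≢0 (n≤0⇒n≡0 (≤-pred (≤-pred (∣⇒≤ (≋0⇒∣ 2≋0)))))

    4≉0 : ¬ 4 ≋ 0
    4≉0 = *-≉0 2≉0 2≉0

    h : ℕ
    h = q / 2

    q≡h*2 : q ≡ h * 2
    q≡h*2 with q % 2 | m%n<n q 2 | m≡m%n+[m/n]*n q 2
    ... | 0           | _            | q≡0+h*2 = q≡0+h*2
    ... | 1           | _            | q≡1+h*2 = ⊥-elim (odd (divides (suc h) (cong suc q≡1+h*2)))
    ... | suc (suc _) | s≤s (s≤s ()) | _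

    h+h≡q : h + h ≡ q
    h+h≡q = trans (solve 1 (λ h → h :+ h := h :* con 2) refl h) (sym q≡h*2)

    0<h : 0 < h
    0<h = n≢0⇒n>0 (λ h≡0 → 0≢1+n (trans (cong (_* 2) (sym h≡0)) (sym q≡h*2)))

    h<q : h < q
    h<q = subst (h <_) h+h≡q (m<m+n h 0<h)

    h*[1+s+s]%q≡h%q : ∀ s → (h * suc (s + s)) % q ≡ h % q
    h*[1+s+s]%q≡h%q s = trans (cong (_% q) h*[1+s+s]≡h+s*q) ([m+kn]%n≡m%n h s q)
      where
      h*[1+s+s]≡h+s*q : h * suc (s + s) ≡ h + s * q
      h*[1+s+s]≡h+s*q = trans (solve 2 (λ h s → h :* (con 1 :+ (s :+ s)) := h :+ s :* (h :+ h)) refl h s) (cong (λ x → h + s * x) h+h≡q)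

    ≋q*⇒≋0 : ∀ {y} → y ≋ q * y → y ≋ 0
    ≋q*⇒≋0 {y} y≋-y with *≋0⇒ 2y≋0
      where
      2y≋0 : 2 * y ≋ 0
      2y≋0 = begin
        2 * y      ≡⟨ solve 1 (λ y → con 2 :* y := y :+ y) refl y ⟩
        y + y      ≈⟨ +-≋ˡ y y≋-y ⟩
        y + q * y  ≈⟨ a+q*a≋0 y ⟩
        0          ∎
    ... | inj₁ 2≋0 = ⊥-elim (2≉0 2≋0)
    ... | inj₂ y≋0 = y≋0

    square-roots : ∀ {y y₀} → y * y ≋ y₀ * y₀ → y ≋ y₀ ⊎ y ≋ q * y₀
    square-roots {y} {y₀} y²≋y₀² with *≋0⇒ [y-y₀][y+y₀]≋0
      where
      [y-y₀][y+y₀]≋0 : (y + q * y₀) * (y + y₀) ≋ 0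
      [y-y₀][y+y₀]≋0 = begin
        (y + q * y₀) * (y + y₀)                    ≡⟨ solve 3 (λ y y₀ q → (y :+ q :* y₀) :* (y :+ y₀) := (y :* y :+ q :* (y₀ :* y₀)) :+ (con 1 :+ q) :* (y :* y₀)) refl y y₀ q ⟩
        (y * y + q * (y₀ * y₀)) + p * (y * y₀)     ≈⟨ a+p*b≋a _ (y * y₀) ⟩
        y * y + q * (y₀ * y₀)                      ≈⟨ ≋⇒+q*≋0 y²≋y₀² ⟩
        0                                          ∎
    ... | inj₁ y-y₀≋0 = inj₁ (+q*≋0⇒≋ y-y₀≋0)
    ... | inj₂ y+y₀≋0 = inj₂ (+q*≋0⇒≋ (≋-trans (+-≋ˡ y (q*[q*a]≋a y₀)) y+y₀≋0))

    a*b^k≋1⇒b≋a : ∀ {a b} → a * b ^ k ≋ 1 → b ≋ a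
    a*b^k≋1⇒b≋a {a} {b} ab^k≋1 with b ≋? 0
    ... | yes b≋0 = ⊥-elim (1≉0 (≋-trans (≋-sym ab^k≋1) (*-≋0ʳ a (^-≋0 k k≢0 b≋0))))
    ... | no b≉0 = begin
      b                  ≡⟨ *-identityʳ b ⟨
      b * 1              ≈⟨ *-≋ˡ b ab^k≋1 ⟨
      b * (a * b ^ k)    ≡⟨ solve 3 (λ a b bk → b :* (a :* bk) := a :* (b :* bk)) refl a b (b ^ k) ⟩
      a * (b * b ^ k)    ≈⟨ *-≋ˡ a (fermat b≉0) ⟩
      a * 1              ≡⟨ *-identityʳ a ⟩
      a                  ∎

    ≋⇒a*b^k≋1 : ∀ {a b} → ¬ a ≋ 0 → b ≋ a → a * b ^ k ≋ 1
    ≋⇒a*b^k≋1 {a} a≉0 b≋a = ≋-trans (*-≋ˡ a (^-≋ k b≋a)) (fermat a≉0)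

    [a^k]^k≋a : ∀ a → (a ^ k) ^ k ≋ a
    [a^k]^k≋a a with a ≋? 0
    ... | yes a≋0 = ≋-trans (^-≋0 k k≢0 (^-≋0 k k≢0 a≋0)) (≋-sym a≋0)
    ... | no a≉0 = begin
      (a ^ k) ^ k                      ≡⟨ *-identityʳ _ ⟨
      (a ^ k) ^ k * 1                  ≈⟨ *-≋ˡ ((a ^ k) ^ k) (a^k*a≋1 a≉0) ⟨
      (a ^ k) ^ k * (a ^ k * a)        ≡⟨ *-assoc ((a ^ k) ^ k) (a ^ k) a ⟨
      ((a ^ k) ^ k * a ^ k) * a        ≈⟨ *-≋ʳ a (a^k*a≋1 (^-≉0 k a≉0)) ⟩
      1 * a                            ≡⟨ *-identityˡ a ⟩
      a                                ∎

  +-^ : ∀ a e → (+ a) ℤ.^ e ≡ + (a ^ e)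
  +-^ a zero    = refl
  +-^ a (suc e) = trans (cong (+ a ℤ.*_) (+-^ a e)) (sym (ℤ.pos-* a (a ^ e)))

  -1^[s+s]≡1 : ∀ s → (ℤ.- + 1) ℤ.^ (s + s) ≡ + 1
  -1^[s+s]≡1 zero    = refl
  -1^[s+s]≡1 (suc s) rewrite +-suc s s = trans (ℤ.-1*i≡-i _) (trans (cong ℤ.-_ (ℤ.-1*i≡-i _)) (trans (ℤ.neg-involutive _) (-1^[s+s]≡1 s)))

  sign-even-split : ∀ x x₁ x₂ a →
    + x ℤ.- + 2 ℤ.* + x₁ ℤ.+ + x₂ ℤ.- + 1 ℤ.* + 4 ℤ.* + a ≡ + (x + x₂) ℤ.- + (2 * x₁ + 4 * a)
  sign-even-split x x₁ x₂ a = trans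
    (solve 4 (λ x x₁ x₂ a → x :- con (+ 2) :* x₁ :+ x₂ :- con (+ 1) :* con (+ 4) :* a
                            := (x :+ x₂) :- (con (+ 2) :* x₁ :+ con (+ 4) :* a)) refl (+ x) (+ x₁) (+ x₂) (+ a))
    (cong₂ ℤ._-_ (sym (ℤ.pos-+ x x₂)) (sym (trans (ℤ.pos-+ (2 * x₁) (4 * a)) (cong₂ ℤ._+_ (ℤ.pos-* 2 x₁) (ℤ.pos-* 4 a)))))
    where open ℤ-Solver.+-*-Solver

  sign-odd-split : ∀ x x₁ x₂ a →
    + x ℤ.- + 2 ℤ.* + x₁ ℤ.+ + x₂ ℤ.- ℤ.- + 1 ℤ.* + 4 ℤ.* + a ≡ + (x + x₂ + 4 * a) ℤ.- + (2 * x₁)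
  sign-odd-split x x₁ x₂ a = trans
    (solve 4 (λ x x₁ x₂ a → x :- con (+ 2) :* x₁ :+ x₂ :- con (ℤ.- + 1) :* con (+ 4) :* a
                            := (x :+ x₂ :+ con (+ 4) :* a) :- (con (+ 2) :* x₁)) refl (+ x) (+ x₁) (+ x₂) (+ a))
    (cong₂ ℤ._-_ (sym (trans (ℤ.pos-+ (x + x₂) (4 * a)) (cong₂ ℤ._+_ (ℤ.pos-+ x x₂) (ℤ.pos-* 4 a)))) (sym (ℤ.pos-* 2 x₁)))
    where open ℤ-Solver.+-*-Solver

  module PropositionArithmetic (k : ℕ) (prime : Prime (suc (suc k))) (odd : ¬ 2 ∣ suc (suc k)) (g : ℕ)
                             (p∤g : ¬ suc (suc k) ∣ g)
                             (g-primitive : ∀ i → 0 < i → i < suc k → ¬ suc (suc k) ∣ g ^ i ∸ 1)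
                             (n : ℕ) (1≤n : 1 ≤ n) (α : ℕ) (p∤α : ¬ suc (suc k) ∣ α) where

    open OddPrimitiveRoot k prime odd g p∤g g-primitive
    open +-*-Solver
    open ≋-Reasoning

    α≉0 : ¬ α ≋ 0
    α≉0 α≋0 = p∤α (≋0⇒∣ α≋0)

    m m₂ : ℕ
    m  = 3 * n
    m₂ = 3 * n ∸ 2

    2<m : 2 < m
    2<m = *-monoʳ-≤ 3 1≤n

    m≡2+m₂ : m ≡ 2 + m₂
    m≡2+m₂ = sym (m+[n∸m]≡n (<⇒≤ 2<m))

    m≢0 : m ≢ 0
    m≢0 m≡0 = 0≢1+n (trans (sym m≡0) m≡2+m₂)

    m₂≢0 : m₂ ≢ 0
    m₂≢0 = >⇒≢ (m<n⇒0<n∸m 2<m)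

    K : ℕ → ℕ → ℕ → ℕ
    K a b d = a ^ m * b ^ k * d ^ (m₂ * k) * α

    M : ℕ → ℕ → ℕ
    M t β = t ^ m * β ^ k * α

    L : ℕ → ℕ → ℕ
    L t β = t + β + 1 + M t β

    m₂*k≢0 : m₂ * k ≢ 0
    m₂*k≢0 m₂*k≡0 with m*n≡0⇒m≡0∨n≡0 m₂ m₂*k≡0
    ... | inj₁ m₂≡0 = m₂≢0 m₂≡0
    ... | inj₂ k≡0  = k≢0 k≡0

    K≋0 : ∀ a b {d} → d ≋ 0 → K a b d ≋ 0
    K≋0 a b d≋0 = *-≋0ˡ α (*-≋0ʳ (a ^ m * b ^ k) (^-≋0 (m₂ * k) m₂*k≢0 d≋0))

    M≉0 : ∀ {t β} → ¬ t ≋ 0 → ¬ β ≋ 0 → ¬ M t β ≋ 0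
    M≉0 t≉0 β≉0 = *-≉0 (*-≉0 (^-≉0 m t≉0) (^-≉0 k β≉0)) α≉0

    M≋0 : ∀ {t} β → t ≋ 0 → M t β ≋ 0
    M≋0 β t≋0 = *-≋0ˡ α (*-≋0ˡ _ (^-≋0 m m≢0 t≋0))

    d^m*d^k*d^[m₂*k]≋d : ∀ {d} → ¬ d ≋ 0 → d ^ m * d ^ k * d ^ (m₂ * k) ≋ d
    d^m*d^k*d^[m₂*k]≋d {d} d≉0 = begin
      d ^ m * d ^ k * d ^ (m₂ * k)     ≡⟨ cong (λ e → e * d ^ (m₂ * k)) (^-distribˡ-+-* d m k) ⟨
      d ^ (m + k) * d ^ (m₂ * k)       ≡⟨ ^-distribˡ-+-* d (m + k) (m₂ * k) ⟨
      d ^ (m + k + m₂ * k)             ≡⟨ cong (d ^_) exponent ⟩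
      d ^ (1 + q * suc m₂)             ≡⟨ cong (d *_) (^-*-assoc d q (suc m₂)) ⟨
      d * (d ^ q) ^ suc m₂             ≈⟨ *-≋ˡ d (^-≋ (suc m₂) (fermat d≉0)) ⟩
      d * 1 ^ suc m₂                   ≡⟨ cong (d *_) (^-zeroˡ (suc m₂)) ⟩
      d * 1                            ≡⟨ *-identityʳ d ⟩
      d                                ∎
      where
      exponent : m + k + m₂ * k ≡ 1 + q * suc m₂
      exponent = trans (cong (λ x → x + k + m₂ * k) m≡2+m₂)
                       (solve 2 (λ m₂ k → con 2 :+ m₂ :+ k :+ m₂ :* k := con 1 :+ (con 1 :+ k) :* (con 1 :+ m₂)) refl m₂ k)

    K-scaled : ∀ {d} → ¬ d ≋ 0 → ∀ t β → K (d * t) (d * β) d ≋ d * M t β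
    K-scaled {d} d≉0 t β = begin
      (d * t) ^ m * (d * β) ^ k * d ^ (m₂ * k) * α
        ≡⟨ cong₂ (λ x y → x * y * d ^ (m₂ * k) * α) (*-^-distrib d t m) (*-^-distrib d β k) ⟩
      d ^ m * t ^ m * (d ^ k * β ^ k) * d ^ (m₂ * k) * α
        ≡⟨ solve 6 (λ dm tm dk βk dm₂k α → dm :* tm :* (dk :* βk) :* dm₂k :* α := (dm :* dk :* dm₂k) :* (tm :* βk :* α)) refl (d ^ m) (t ^ m) (d ^ k) (β ^ k) (d ^ (m₂ * k)) α ⟩
      (d ^ m * d ^ k * d ^ (m₂ * k)) * M t β
        ≈⟨ *-≋ʳ (M t β) (d^m*d^k*d^[m₂*k]≋d d≉0) ⟩
      d * M t β
        ∎

    β*L≋β²+[1+t]β+t^mα : ∀ t {β} → ¬ β ≋ 0 → β * L t β ≋ β * β + suc t * β + t ^ m * α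
    β*L≋β²+[1+t]β+t^mα t {β} β≉0 = begin
      β * (t + β + 1 + t ^ m * β ^ k * α)
        ≡⟨ solve 5 (λ β t tm βk α → β :* (t :+ β :+ con 1 :+ tm :* βk :* α) := β :* β :+ (con 1 :+ t) :* β :+ (β :* βk) :* (tm :* α)) refl β t (t ^ m) (β ^ k) α ⟩
      β * β + suc t * β + (β * β ^ k) * (t ^ m * α)
        ≈⟨ +-≋ˡ (β * β + suc t * β) (*-≋ʳ (t ^ m * α) (fermat β≉0)) ⟩
      β * β + suc t * β + 1 * (t ^ m * α)
        ≡⟨ cong (λ x → β * β + suc t * β + x) (*-identityˡ (t ^ m * α)) ⟩
      β * β + suc t * β + t ^ m * α
        ∎

    d*L≡ : ∀ d t β → d * L t β ≡ d * t + d * β + d + d * M t β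
    d*L≡ d t β = solve 4 (λ d t β M → d :* (t :+ β :+ con 1 :+ M) := d :* t :+ d :* β :+ d :+ d :* M) refl d t β (M t β)

    K-≋ : ∀ {a a′ b b′} d → a ≋ a′ → b ≋ b′ → K a b d ≋ K a′ b′ d
    K-≋ d a≋a′ b≋b′ = *-≋ʳ α (*-≋ʳ (d ^ (m₂ * k)) (*-≋ (^-≋ m a≋a′) (^-≋ k b≋b′)))

    -- cond t: the discriminant of β² + (1 + t) β + t^m α vanishes.
    cond : ℕ → Set
    cond t = suc t * suc t ≋ 4 * (t ^ m * α)

    cond? : ∀ t → Dec (cond t)
    cond? t = suc t * suc t ≋? 4 * (t ^ m * α)

    ¬cond[0] : ∀ {t} → t ≋ 0 → ¬ cond t
    ¬cond[0] {t} t≋0 c = 1≉0 (begin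
      1                       ≡⟨⟩
      suc 0 * suc 0           ≈⟨ *-≋ (+-≋ˡ 1 t≋0) (+-≋ˡ 1 t≋0) ⟨
      suc t * suc t           ≈⟨ c ⟩
      4 * (t ^ m * α)         ≈⟨ *-≋0ʳ 4 (*-≋0ˡ α (^-≋0 m m≢0 t≋0)) ⟩
      0                       ∎)

    m*h%q≡n*h%q : (m * h) % q ≡ (n * h) % q
    m*h%q≡n*h%q = trans (cong (_% q) m*h≡n*h+n*q) ([m+kn]%n≡m%n (n * h) n q)
      where
      m*h≡n*h+n*q : m * h ≡ n * h + n * q
      m*h≡n*h+n*q = trans (solve 2 (λ n h → con 3 :* n :* h := n :* h :+ n :* (h :+ h)) refl n h) (cong (λ x → n * h + n * x) h+h≡q)

    m₁ : ℕ
    m₁ = 3 * n ∸ 1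

    m₁≡1+m₂ : m₁ ≡ suc m₂
    m₁≡1+m₂ = cong (_∸ 1) m≡2+m₂

    m₁≢0 : m₁ ≢ 0
    m₁≢0 m₁≡0 = 0≢1+n (trans (sym m₁≡0) m₁≡1+m₂)

    σ : ℕ → ℕ
    σ y = q * y ^ k

    σ-resp : ∀ {x y} → x ≋ y → σ x ≋ σ y
    σ-resp x≋y = *-≋ˡ q (^-≋ k x≋y)

    σ≋0 : ∀ {y} → y ≋ 0 → σ y ≋ 0
    σ≋0 y≋0 = *-≋0ʳ q (^-≋0 k k≢0 y≋0)

    σ[y]*y≋q : ∀ {y} → ¬ y ≋ 0 → σ y * y ≋ q
    σ[y]*y≋q {y} y≉0 = begin
      q * y ^ k * y    ≡⟨ *-assoc q (y ^ k) y ⟩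
      q * (y ^ k * y)  ≈⟨ *-≋ˡ q (a^k*a≋1 y≉0) ⟩
      q * 1            ≡⟨ *-identityʳ q ⟩
      q                ∎

    q^k≋q : q ^ k ≋ q
    q^k≋q = begin
      q ^ k              ≡⟨ *-identityʳ (q ^ k) ⟨
      q ^ k * 1          ≈⟨ *-≋ˡ (q ^ k) q*q≋1 ⟨
      q ^ k * (q * q)    ≡⟨ *-assoc (q ^ k) q q ⟨
      q ^ k * q * q      ≈⟨ *-≋ʳ q (a^k*a≋1 q≉0) ⟩
      1 * q              ≡⟨ *-identityˡ q ⟩
      q                  ∎

    σ-involutive : ∀ y → σ (σ y) ≋ y
    σ-involutive y = begin
      q * (q * y ^ k) ^ k          ≡⟨ cong (q *_) (*-^-distrib q (y ^ k) k) ⟩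
      q * (q ^ k * (y ^ k) ^ k)    ≈⟨ *-≋ˡ q (*-≋ q^k≋q ([a^k]^k≋a y)) ⟩
      q * (q * y)                  ≈⟨ q*[q*a]≋a y ⟩
      y                            ∎

    q^[s+s]≋1 : ∀ s → q ^ (s + s) ≋ 1
    q^[s+s]≋1 s = begin
      q ^ (s + s)          ≡⟨ ^-distribˡ-+-* q s s ⟩
      q ^ s * q ^ s        ≡⟨ *-^-distrib q q s ⟨
      (q * q) ^ s          ≈⟨ ^-≋ s q*q≋1 ⟩
      1 ^ s                ≡⟨ ^-zeroˡ s ⟩
      1                    ∎

    q^n≋q^m₂ : q ^ n ≋ q ^ m₂
    q^n≋q^m₂ = begin
      q ^ n                      ≡⟨ *-identityʳ (q ^ n) ⟨
      q ^ n * 1                  ≈⟨ *-≋ˡ (q ^ n) (q^[s+s]≋1 n) ⟨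
      q ^ n * q ^ (n + n)        ≡⟨ ^-distribˡ-+-* q n (n + n) ⟨
      q ^ (n + (n + n))          ≡⟨ cong (q ^_) (solve 1 (λ n → n :+ (n :+ n) := con 3 :* n) refl n) ⟩
      q ^ m                      ≡⟨ cong (q ^_) m≡2+m₂ ⟩
      q * (q * q ^ m₂)           ≡⟨ *-assoc q q (q ^ m₂) ⟨
      q * q * q ^ m₂             ≈⟨ *-≋ʳ (q ^ m₂) q*q≋1 ⟩
      1 * q ^ m₂                 ≡⟨ *-identityˡ (q ^ m₂) ⟩
      q ^ m₂                     ∎

    -- f̂ and Ĝ are the residues of f_x(y) and of (1 + t)² - 4 t^m α, with q standing for -1.
    f̂ : ℕ → ℕ
    f̂ y = y ^ m + y ^ m₂ + q * (2 * y ^ m₁ + q ^ n * (4 * α))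

    Ĝ : ℕ → ℕ
    Ĝ t = suc t * suc t + q * (4 * (t ^ m * α))

    -- With t = -1/y, i.e. t y = -1, multiplying f̂ y by t^m gives (-1)^m₂ Ĝ t.
    t^m*f̂[y]≋q^m₂*Ĝ[t] : ∀ {y} → ¬ y ≋ 0 → σ y ^ m * f̂ y ≋ q ^ m₂ * Ĝ (σ y)
    t^m*f̂[y]≋q^m₂*Ĝ[t] {y} y≉0 = begin
      t ^ m * (y ^ m + y ^ m₂ + q * (2 * y ^ m₁ + q ^ n * (4 * α)))
        ≡⟨ cong₂ (λ e e₁ → t ^ e * (y ^ e + y ^ m₂ + q * (2 * y ^ e₁ + q ^ n * (4 * α)))) m≡2+m₂ m₁≡1+m₂ ⟩
      t * (t * t ^ m₂) * (y * (y * y ^ m₂) + y ^ m₂ + q * (2 * (y * y ^ m₂) + q ^ n * (4 * α)))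
        ≡⟨ solve 7 (λ t y T Y q s α → t :* (t :* T) :* (y :* (y :* Y) :+ Y :+ q :* (con 2 :* (y :* Y) :+ s :* (con 4 :* α)))
                    := (T :* Y) :* ((t :* y) :* (t :* y) :+ t :* t :+ con 2 :* q :* t :* (t :* y)) :+ q :* s :* (con 4 :* (t :* (t :* T) :* α)))
                    refl t y (t ^ m₂) (y ^ m₂) q (q ^ n) α ⟩
      (t ^ m₂ * y ^ m₂) * ((t * y) * (t * y) + t * t + 2 * q * t * (t * y)) + q * q ^ n * (4 * (t * (t * t ^ m₂) * α))
        ≈⟨ +-≋ (*-≋ t^m₂y^m₂≋q^m₂ (+-≋ (+-≋ʳ (t * t) (*-≋ ty≋q ty≋q)) (*-≋ˡ (2 * q * t) ty≋q))) (*-≋ʳ _ (*-≋ˡ q q^n≋q^m₂)) ⟩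
      q ^ m₂ * (q * q + t * t + 2 * q * t * q) + q * q ^ m₂ * (4 * (t * (t * t ^ m₂) * α))
        ≡⟨ cong (λ x → q ^ m₂ * x + q * q ^ m₂ * (4 * (t * (t * t ^ m₂) * α))) (solve 2 (λ q t → q :* q :+ t :* t :+ con 2 :* q :* t :* q := q :* q :* (con 1 :+ con 2 :* t) :+ t :* t) refl q t) ⟩
      q ^ m₂ * (q * q * (1 + 2 * t) + t * t) + q * q ^ m₂ * (4 * (t * (t * t ^ m₂) * α))
        ≈⟨ +-≋ʳ _ (*-≋ˡ (q ^ m₂) (+-≋ʳ (t * t) (*-≋ʳ (1 + 2 * t) q*q≋1))) ⟩
      q ^ m₂ * (1 * (1 + 2 * t) + t * t) + q * q ^ m₂ * (4 * (t * (t * t ^ m₂) * α))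
        ≡⟨ solve 5 (λ Q t tm α q → Q :* (con 1 :* (con 1 :+ con 2 :* t) :+ t :* t) :+ q :* Q :* (con 4 :* (tm :* α))
                    := Q :* ((con 1 :+ t) :* (con 1 :+ t) :+ q :* (con 4 :* (tm :* α)))) refl (q ^ m₂) t (t * (t * t ^ m₂)) α q ⟩
      q ^ m₂ * (suc t * suc t + q * (4 * (t * (t * t ^ m₂) * α)))
        ≡⟨ cong (λ e → q ^ m₂ * (suc t * suc t + q * (4 * (t ^ e * α)))) m≡2+m₂ ⟨
      q ^ m₂ * Ĝ t
        ∎
      where
      t : ℕ
      t = σ y
      ty≋q : t * y ≋ q
      ty≋q = σ[y]*y≋q y≉0
      t^m₂y^m₂≋q^m₂ : t ^ m₂ * y ^ m₂ ≋ q ^ m₂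
      t^m₂y^m₂≋q^m₂ = ≋-trans (≡⇒≋ (sym (*-^-distrib t y m₂))) (^-≋ m₂ ty≋q)

    f̂≋0⇔cond[σ] : ∀ y → f̂ y ≋ 0 ⇔ cond (σ y)
    f̂≋0⇔cond[σ] y with y ≋? 0
    ... | yes y≋0 = mk⇔ (λ f̂≋0 → ⊥-elim (f̂[0]≉0 f̂≋0)) (λ c → ⊥-elim (¬cond[0] (σ≋0 y≋0) c))
      where
      f̂[0]≉0 : ¬ f̂ y ≋ 0
      f̂[0]≉0 f̂≋0 = *-≉0 q≉0 (*-≉0 (^-≉0 n q≉0) (*-≉0 4≉0 α≉0)) (≋-trans (≋-sym f̂≋) f̂≋0)
        where
        f̂≋ : f̂ y ≋ q * (q ^ n * (4 * α))
        f̂≋ = +-≋ (+-≋ (^-≋0 m m≢0 y≋0) (^-≋0 m₂ m₂≢0 y≋0)) (*-≋ˡ q (+-≋ʳ _ (*-≋0ʳ 2 (^-≋0 m₁ m₁≢0 y≋0))))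
    ... | no y≉0 = mk⇔
      (λ f̂≋0 → +q*≋0⇒≋ (Equivalence.to f̂≋0⇔Ĝ≋0 f̂≋0))
      (λ c → Equivalence.from f̂≋0⇔Ĝ≋0 (≋⇒+q*≋0 c))
      where
      f̂≋0⇔Ĝ≋0 : f̂ y ≋ 0 ⇔ Ĝ (σ y) ≋ 0
      f̂≋0⇔Ĝ≋0 = unit-multiples-≋0 (^-≉0 m (*-≉0 q≉0 (^-≉0 k y≉0))) (^-≉0 m₂ q≉0) (t^m*f̂[y]≋q^m₂*Ĝ[t] y≉0)

    fpoly≡ : ∀ y → fpoly n α y ≡ + (y ^ m) ℤ.- + 2 ℤ.* + (y ^ m₁) ℤ.+ + (y ^ m₂) ℤ.- (ℤ.- + 1) ℤ.^ n ℤ.* + 4 ℤ.* + α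
    fpoly≡ y = cong (λ x → x ℤ.- (ℤ.- + 1) ℤ.^ n ℤ.* + 4 ℤ.* + α)
                    (cong₂ ℤ._+_ (cong₂ ℤ._-_ (+-^ y m) (cong (+ 2 ℤ.*_) (+-^ y m₁))) (+-^ y m₂))

    fpoly-as-difference : ∀ y → ∃₂ λ a b → fpoly n α y ≡ + a ℤ.- + b × f̂ y ≋ a + q * b
    fpoly-as-difference y with even-or-odd n
    ... | s , inj₁ n≡s+s = y ^ m + y ^ m₂ , 2 * y ^ m₁ + 4 * α ,
        trans (fpoly≡ y) (trans (cong (λ S → + (y ^ m) ℤ.- + 2 ℤ.* + (y ^ m₁) ℤ.+ + (y ^ m₂) ℤ.- S ℤ.* + 4 ℤ.* + α) sign)
                            (sign-even-split (y ^ m) (y ^ m₁) (y ^ m₂) α)) ,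
        +-≋ˡ (y ^ m + y ^ m₂) (*-≋ˡ q (+-≋ˡ (2 * y ^ m₁) (≋-trans (*-≋ʳ (4 * α) q^n≋1) (≡⇒≋ (*-identityˡ (4 * α))))))
      where
      sign : (ℤ.- + 1) ℤ.^ n ≡ + 1
      sign = trans (cong ((ℤ.- + 1) ℤ.^_) n≡s+s) (-1^[s+s]≡1 s)
      q^n≋1 : q ^ n ≋ 1
      q^n≋1 = ≋-trans (≡⇒≋ (cong (q ^_) n≡s+s)) (q^[s+s]≋1 s)
    ... | s , inj₂ n≡1+s+s = y ^ m + y ^ m₂ + 4 * α , 2 * y ^ m₁ ,
        trans (fpoly≡ y) (trans (cong (λ S → + (y ^ m) ℤ.- + 2 ℤ.* + (y ^ m₁) ℤ.+ + (y ^ m₂) ℤ.- S ℤ.* + 4 ℤ.* + α) sign)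
                            (sign-odd-split (y ^ m) (y ^ m₁) (y ^ m₂) α)) ,
        (begin
          y ^ m + y ^ m₂ + q * (2 * y ^ m₁ + q ^ n * (4 * α))       ≈⟨ +-≋ˡ (y ^ m + y ^ m₂) (*-≋ˡ q (+-≋ˡ (2 * y ^ m₁) (*-≋ʳ (4 * α) q^n≋q))) ⟩
          y ^ m + y ^ m₂ + q * (2 * y ^ m₁ + q * (4 * α))           ≡⟨ solve 5 (λ a b c q d → a :+ b :+ q :* (c :+ q :* d) := a :+ b :+ (q :* q) :* d :+ q :* c) refl (y ^ m) (y ^ m₂) (2 * y ^ m₁) q (4 * α) ⟩
          y ^ m + y ^ m₂ + (q * q) * (4 * α) + q * (2 * y ^ m₁)     ≈⟨ +-≋ʳ (q * (2 * y ^ m₁)) (+-≋ˡ (y ^ m + y ^ m₂) (≋-trans (*-≋ʳ (4 * α) q*q≋1) (≡⇒≋ (*-identityˡ (4 * α))))) ⟩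
          y ^ m + y ^ m₂ + 4 * α + q * (2 * y ^ m₁)                  ∎)
      where
      sign : (ℤ.- + 1) ℤ.^ n ≡ ℤ.- + 1
      sign = trans (cong ((ℤ.- + 1) ℤ.^_) n≡1+s+s) (cong ((ℤ.- + 1) ℤ.*_) (-1^[s+s]≡1 s))
      q^n≋q : q ^ n ≋ q
      q^n≋q = ≋-trans (≡⇒≋ (cong (q ^_) n≡1+s+s)) (≋-trans (*-≋ˡ q (q^[s+s]≋1 s)) (≡⇒≋ (*-identityʳ q)))

    cond-resp : ∀ {t t′} → t ≋ t′ → cond t → cond t′
    cond-resp t≋t′ c = ≋-trans (≋-sym (*-≋ (+-≋ˡ 1 t≋t′) (+-≋ˡ 1 t≋t′))) (≋-trans c (*-≋ˡ 4 (*-≋ʳ α (^-≋ m t≋t′))))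

    fpoly-root⇔cond[σ] : ∀ y → p ∣ ℤ.∣ fpoly n α y ∣ ⇔ cond (σ y)
    fpoly-root⇔cond[σ] y with fpoly-as-difference y
    ... | a , b , fpoly≡a-b , f̂≋a-b = mk⇔
      (λ p∣f → Equivalence.to (f̂≋0⇔cond[σ] y)
                 (≋-trans f̂≋a-b (≋⇒+q*≋0 {a} {b} (∣+a-+b∣⇒≋ {a} {b} (subst (λ z → p ∣ ℤ.∣ z ∣) fpoly≡a-b p∣f)))))
      (λ c → subst (λ z → p ∣ ℤ.∣ z ∣) (sym fpoly≡a-b)
               (≋⇒∣+a-+b∣ {a} {b} (+q*≋0⇒≋ {a} {b} (≋-trans (≋-sym f̂≋a-b) (Equivalence.from (f̂≋0⇔cond[σ] y) c)))))

open ModularArithmetic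

module _ {c ℓ : Level} (R : CommutativeRing c ℓ) where

  open CommutativeRing R

  -- sumTo, pow and fromℕ are defined inside the parametrised module Chars,
  -- whose parameters they ignore.
  module FiniteSums (p g : ℕ) (ω ζ : Carrier) where

    open Chars R p g ω ζ public using (sumTo; fromℕ; pow)
    open import Relation.Binary.Reasoning.Setoid setoid
    open import Algebra.Properties.Ring ring public using (-1*x≈-x)
    open import Algebra.Properties.CommutativeSemiring.Exp commutativeSemiring using (_^_; ^-homo-*; ^-assocʳ; ^-congˡ)
    open import Algebra.Properties.Semiring.Mult semiring using (×1-homo-*) renaming (_×_ to _×ᵣ_)
    open import Algebra.Solver.Ring.NaturalCoefficients.Default commutativeSemiring public

    pow≡^ : ∀ x n → pow x n ≡ x ^ n
    pow≡^ x zero    = ≡.refl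
    pow≡^ x (suc n) = ≡.cong (x *_) (pow≡^ x n)

    pow-+ : ∀ x m n → pow x (m ℕ.+ n) ≈ pow x m * pow x n
    pow-+ x m n rewrite pow≡^ x (m ℕ.+ n) | pow≡^ x m | pow≡^ x n = ^-homo-* x m n

    pow-* : ∀ x m n → pow x (m ℕ.* n) ≈ pow (pow x m) n
    pow-* x m n rewrite pow≡^ x (m ℕ.* n) | pow≡^ (pow x m) n | pow≡^ x m = sym (^-assocʳ x m n)

    pow-cong : ∀ {x y} n → x ≈ y → pow x n ≈ pow y n
    pow-cong {x} {y} n x≈y rewrite pow≡^ x n | pow≡^ y n = ^-congˡ n x≈y

    pow-1# : ∀ n → pow 1# n ≈ 1#
    pow-1# zero    = refl
    pow-1# (suc n) = trans (*-identityˡ _) (pow-1# n)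

    pow-%-periodic : ∀ {x} N .{{_ : ℕ.NonZero N}} → pow x N ≈ 1# → ∀ a → pow x a ≈ pow x (a ℕ.% N)
    pow-%-periodic {x} N x^N≈1 a = begin
      pow x a                                     ≡⟨ ≡.cong (pow x) (m≡m%n+[m/n]*n a N) ⟩
      pow x (a ℕ.% N ℕ.+ a ℕ./ N ℕ.* N)           ≈⟨ pow-+ x (a ℕ.% N) _ ⟩
      pow x (a ℕ.% N) * pow x (a ℕ./ N ℕ.* N)     ≡⟨ ≡.cong (λ e → pow x (a ℕ.% N) * pow x e) (ℕ.*-comm (a ℕ./ N) N) ⟩
      pow x (a ℕ.% N) * pow x (N ℕ.* (a ℕ./ N))   ≈⟨ *-congˡ (pow-* x N (a ℕ./ N)) ⟩
      pow x (a ℕ.% N) * pow (pow x N) (a ℕ./ N)   ≈⟨ *-congˡ (trans (pow-cong (a ℕ./ N) x^N≈1) (pow-1# (a ℕ./ N))) ⟩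
      pow x (a ℕ.% N) * 1#                        ≈⟨ *-identityʳ _ ⟩
      pow x (a ℕ.% N)                             ∎

    fromℕ≡× : ∀ n → fromℕ n ≡ n ×ᵣ 1#
    fromℕ≡× zero    = ≡.refl
    fromℕ≡× (suc n) = ≡.cong (λ x → 1# + x) (fromℕ≡× n)

    fromℕ-* : ∀ m n → fromℕ (m ℕ.* n) ≈ fromℕ m * fromℕ n
    fromℕ-* m n rewrite fromℕ≡× (m ℕ.* n) | fromℕ≡× m | fromℕ≡× n = ×1-homo-* m n

    [_] : ∀ {a} {P : Set a} → Dec P → Carrier
    [ yes _ ] = 1#
    [ no  _ ] = 0#

    []-cong : ∀ {a b} {P : Set a} {Q : Set b} (P? : Dec P) (Q? : Dec Q) → (P → Q) → (Q → P) → [ P? ] ≈ [ Q? ]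
    []-cong (yes _) (yes _) _   _   = refl
    []-cong (yes P) (no ¬Q) P→Q _   = ⊥-elim (¬Q (P→Q P))
    []-cong (no ¬P) (yes Q) _   Q→P = ⊥-elim (¬P (Q→P Q))
    []-cong (no _)  (no _)  _   _   = refl

    []-no : ∀ {a} {P : Set a} (P? : Dec P) → ¬ P → [ P? ] ≈ 0#
    []-no (yes P) ¬P = ⊥-elim (¬P P)
    []-no (no _)  _  = refl

    sum-cong< : ∀ N {f h : ℕ → Carrier} → (∀ x → x < N → f x ≈ h x) → sumTo N f ≈ sumTo N h
    sum-cong< zero    f≈h = refl
    sum-cong< (suc N) f≈h = +-cong (sum-cong< N (λ x x<N → f≈h x (ℕ.m<n⇒m<1+n x<N))) (f≈h N ℕ.≤-refl)

    sum-cong : ∀ N {f h : ℕ → Carrier} → (∀ x → f x ≈ h x) → sumTo N f ≈ sumTo N h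
    sum-cong N f≈h = sum-cong< N (λ x _ → f≈h x)

    sum-zero : ∀ N {f : ℕ → Carrier} → (∀ x → x < N → f x ≈ 0#) → sumTo N f ≈ 0#
    sum-zero zero    f≈0 = refl
    sum-zero (suc N) f≈0 = trans (+-cong (sum-zero N (λ x x<N → f≈0 x (ℕ.m<n⇒m<1+n x<N))) (f≈0 N ℕ.≤-refl)) (+-identityˡ 0#)

    sum-+ : ∀ N (f h : ℕ → Carrier) → sumTo N (λ x → f x + h x) ≈ sumTo N f + sumTo N h
    sum-+ zero    f h = sym (+-identityˡ 0#)
    sum-+ (suc N) f h = begin
      sumTo N (λ x → f x + h x) + (f N + h N)  ≈⟨ +-congʳ (sum-+ N f h) ⟩
      (sumTo N f + sumTo N h) + (f N + h N)    ≈⟨ solve 4 (λ a b c d → (a :+ b) :+ (c :+ d) := (a :+ c) :+ (b :+ d)) refl (sumTo N f) (sumTo N h) (f N) (h N) ⟩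
      (sumTo N f + f N) + (sumTo N h + h N)    ∎

    sum-distribˡ : ∀ N a (f : ℕ → Carrier) → a * sumTo N f ≈ sumTo N (λ x → a * f x)
    sum-distribˡ zero    a f = zeroʳ a
    sum-distribˡ (suc N) a f = trans (distribˡ a (sumTo N f) (f N)) (+-congʳ (sum-distribˡ N a f))

    sum-distribʳ : ∀ N a (f : ℕ → Carrier) → sumTo N f * a ≈ sumTo N (λ x → f x * a)
    sum-distribʳ N a f = trans (*-comm _ a) (trans (sum-distribˡ N a f) (sum-cong N (λ x → *-comm a (f x))))

    sum-neg : ∀ N (f : ℕ → Carrier) → sumTo N (λ x → - f x) ≈ - sumTo N f
    sum-neg N f = begin
      sumTo N (λ x → - f x)       ≈⟨ sum-cong N (λ x → sym (-1*x≈-x (f x))) ⟩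
      sumTo N (λ x → - 1# * f x)  ≈⟨ sum-distribˡ N (- 1#) f ⟨
      - 1# * sumTo N f            ≈⟨ -1*x≈-x _ ⟩
      - sumTo N f                 ∎

    sum-1# : ∀ N → sumTo N (λ _ → 1#) ≈ fromℕ N
    sum-1# zero    = refl
    sum-1# (suc N) = trans (+-congʳ (sum-1# N)) (+-comm _ 1#)

    sum-swap : ∀ N M (F : ℕ → ℕ → Carrier) →
               sumTo N (λ x → sumTo M (F x)) ≈ sumTo M (λ y → sumTo N (λ x → F x y))
    sum-swap zero    M F = sym (sum-zero M (λ _ _ → refl))
    sum-swap (suc N) M F = begin
      sumTo N (λ x → sumTo M (F x)) + sumTo M (F N)          ≈⟨ +-congʳ (sum-swap N M F) ⟩
      sumTo M (λ y → sumTo N (λ x → F x y)) + sumTo M (F N)  ≈⟨ sum-+ M _ _ ⟨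
      sumTo M (λ y → sumTo N (λ x → F x y) + F N y)          ∎

    sum-product : ∀ N M (f h : ℕ → Carrier) → sumTo N f * sumTo M h ≈ sumTo N (λ x → sumTo M (λ y → f x * h y))
    sum-product N M f h = trans (sum-distribʳ N (sumTo M h) f) (sum-cong N (λ x → sum-distribˡ M (f x) h))

    sum-head : ∀ N (f : ℕ → Carrier) → sumTo (suc N) f ≈ f 0 + sumTo N (λ x → f (suc x))
    sum-head zero    f = trans (+-identityˡ _) (sym (+-identityʳ _))
    sum-head (suc N) f = trans (+-congʳ (sum-head N f)) (+-assoc _ _ _)

    sum-delta : ∀ N {x₀} (f : ℕ → Carrier) → x₀ < N → sumTo N (λ x → [ x ℕ.≟ x₀ ] * f x) ≈ f x₀
    sum-delta (suc N) {x₀} f x₀<1+N with N ℕ.≟ x₀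
    ... | yes ≡.refl = begin
      sumTo N (λ x → [ x ℕ.≟ N ] * f x) + 1# * f N  ≈⟨ +-cong (sum-zero N (λ x x<N → trans (*-congʳ ([]-no (x ℕ.≟ N) (ℕ.<⇒≢ x<N))) (zeroˡ _))) (*-identityˡ _) ⟩
      0# + f N                                      ≈⟨ +-identityˡ _ ⟩
      f N                                           ∎
    ... | no N≢x₀ = begin
      sumTo N (λ x → [ x ℕ.≟ x₀ ] * f x) + 0# * f N  ≈⟨ +-cong (sum-delta N f (ℕ.≤∧≢⇒< (ℕ.≤-pred x₀<1+N) (N≢x₀ ∘ ≡.sym))) (zeroˡ _) ⟩
      f x₀ + 0#                                      ≈⟨ +-identityʳ _ ⟩
      f x₀                                           ∎

    geometric-sum : ∀ w N → w * sumTo N (pow w) + 1# ≈ sumTo N (pow w) + pow w N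
    geometric-sum w zero    = trans (+-congʳ (zeroʳ w)) (trans (+-identityˡ 1#) (sym (+-identityˡ 1#)))
    geometric-sum w (suc N) = begin
      w * (sumTo N (pow w) + pow w N) + 1#           ≈⟨ +-congʳ (distribˡ w _ _) ⟩
      (w * sumTo N (pow w) + w * pow w N) + 1#       ≈⟨ solve 3 (λ a b c → (a :+ b) :+ c := (a :+ c) :+ b) refl _ _ _ ⟩
      (w * sumTo N (pow w) + 1#) + w * pow w N       ≈⟨ +-congʳ (geometric-sum w N) ⟩
      (sumTo N (pow w) + pow w N) + w * pow w N      ∎

    sum-product₄ : ∀ N (f₁ f₂ f₃ f₄ : ℕ → Carrier) x →
      sumTo N f₁ * sumTo N f₂ * sumTo N f₃ * sumTo N f₄ * x ≈
      sumTo N (λ a → sumTo N (λ b → sumTo N (λ c → sumTo N (λ d → f₁ a * f₂ b * f₃ c * f₄ d * x))))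
    sum-product₄ N f₁ f₂ f₃ f₄ x = begin
      sumTo N f₁ * sumTo N f₂ * sumTo N f₃ * sumTo N f₄ * x
        ≈⟨ *-congʳ (*-congʳ (*-congʳ (sum-product N N f₁ f₂))) ⟩
      sumTo N (λ a → sumTo N (λ b → f₁ a * f₂ b)) * sumTo N f₃ * sumTo N f₄ * x
        ≈⟨ *-congʳ (*-congʳ (trans (sum-distribʳ N _ _) (sum-cong N (λ a → sum-product N N _ f₃)))) ⟩
      sumTo N (λ a → sumTo N (λ b → sumTo N (λ c → f₁ a * f₂ b * f₃ c))) * sumTo N f₄ * x
        ≈⟨ *-congʳ (trans (sum-distribʳ N _ _) (sum-cong N (λ a → trans (sum-distribʳ N _ _) (sum-cong N (λ b → sum-product N N _ f₄))))) ⟩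
      sumTo N (λ a → sumTo N (λ b → sumTo N (λ c → sumTo N (λ d → f₁ a * f₂ b * f₃ c * f₄ d)))) * x
        ≈⟨ trans (sum-distribʳ N _ _) (sum-cong N (λ a → trans (sum-distribʳ N _ _) (sum-cong N (λ b → trans (sum-distribʳ N _ _) (sum-cong N (λ c → sum-distribʳ N x _)))))) ⟩
      sumTo N (λ a → sumTo N (λ b → sumTo N (λ c → sumTo N (λ d → f₁ a * f₂ b * f₃ c * f₄ d * x)))) ∎

    length-filter-∷ : ∀ {a} {P : ℕ → Set a} (P? : ∀ x → Dec (P x)) x xs →
                      fromℕ (length (filter P? (x ∷ xs))) ≈ [ P? x ] + fromℕ (length (filter P? xs))
    length-filter-∷ P? x xs with P? x
    ... | yes _ = refl
    ... | no  _ = sym (+-identityˡ _)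

    count-as-sum : ∀ {a} {P : ℕ → Set a} (P? : ∀ x → Dec (P x)) N f →
                   fromℕ (length (filter P? (applyUpTo f N))) ≈ sumTo N (λ i → [ P? (f i) ])
    count-as-sum P? zero    f = refl
    count-as-sum P? (suc N) f =
      trans (length-filter-∷ P? (f 0) _) (trans (+-congˡ (count-as-sum P? N (f ∘ suc))) (sym (sum-head N (λ i → [ P? (f i) ]))))

  module IntegralDomain (domain : ∀ a b → a * b ≈ 0# → a ≈ 0# ⊎ b ≈ 0#) where

    open import Relation.Binary.Reasoning.Setoid setoid
    open import Algebra.Properties.Group +-group using (x∙y⁻¹≈ε⇒x≈y; inverseˡ-unique)
    open import Algebra.Properties.Ring ring using ([y-z]x≈yx-zx)

    x*y≈y⇒y≈0 : ∀ {x y} → ¬ x ≈ 1# → x * y ≈ y → y ≈ 0#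
    x*y≈y⇒y≈0 {x} {y} x≉1 xy≈y with domain (x - 1#) y (begin
      (x - 1#) * y      ≈⟨ [y-z]x≈yx-zx y x 1# ⟩
      x * y - 1# * y    ≈⟨ +-cong xy≈y (-‿cong (*-identityˡ y)) ⟩
      y - y             ≈⟨ -‿inverseʳ y ⟩
      0#                ∎)
    ... | inj₁ x-1≈0 = ⊥-elim (x≉1 (x∙y⁻¹≈ε⇒x≈y x 1# x-1≈0))
    ... | inj₂ y≈0   = y≈0

    x*x≈1⇒x≈±1 : ∀ {x} → x * x ≈ 1# → x ≈ 1# ⊎ x ≈ - 1#
    x*x≈1⇒x≈±1 {x} x²≈1 with domain (x - 1#) (x + 1#) (begin
      (x - 1#) * (x + 1#)            ≈⟨ [y-z]x≈yx-zx (x + 1#) x 1# ⟩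
      x * (x + 1#) - 1# * (x + 1#)   ≈⟨ +-cong (distribˡ x x 1#) (-‿cong (*-identityˡ _)) ⟩
      (x * x + x * 1#) - (x + 1#)    ≈⟨ +-congʳ (+-cong x²≈1 (*-identityʳ x)) ⟩
      (1# + x) - (x + 1#)            ≈⟨ +-congʳ (+-comm 1# x) ⟩
      (x + 1#) - (x + 1#)            ≈⟨ -‿inverseʳ _ ⟩
      0#                             ∎)
    ... | inj₁ x-1≈0 = inj₁ (x∙y⁻¹≈ε⇒x≈y x 1# x-1≈0)
    ... | inj₂ x+1≈0 = inj₂ (inverseˡ-unique x 1# x+1≈0)

  module Characters
    (domain : ∀ a b → a * b ≈ 0# → a ≈ 0# ⊎ b ≈ 0#)
    (k : ℕ) (prime : Prime (suc (suc k))) (odd : ¬ 2 ∣ suc (suc k))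
    (g : ℕ) (p∤g : ¬ suc (suc k) ∣ g)
    (g-primitive : ∀ i → 0 < i → i < suc k → ¬ suc (suc k) ∣ g ℕ.^ i ∸ 1)
    (ω ζ : Carrier)
    (ω^q≈1 : Chars.pow R (suc (suc k)) g ω ζ ω (suc k) ≈ 1#)
    (ω-primitive : ∀ i → 0 < i → i < suc k → ¬ Chars.pow R (suc (suc k)) g ω ζ ω i ≈ 1#)
    (ζ^p≈1 : Chars.pow R (suc (suc k)) g ω ζ ζ (suc (suc k)) ≈ 1#)
    where

    open IntegralDomain domain public
    open OddPrimitiveRoot k prime odd g p∤g g-primitive public
    open FiniteSums p g ω ζ public
    open Chars R p g ω ζ public using (char; gauss; δ; C; LHS)
    open import Relation.Binary.Reasoning.Setoid setoid
    open import Algebra.Properties.Group +-group using (∙-cancelʳ; ε⁻¹≈ε)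

    ω^-cong : ∀ a b → a ℕ.% q ≡ b ℕ.% q → pow ω a ≈ pow ω b
    ω^-cong a b a≡b = trans (pow-%-periodic q ω^q≈1 a) (trans (reflexive (≡.cong (pow ω) a≡b)) (sym (pow-%-periodic q ω^q≈1 b)))

    ω^≉1 : ∀ a → a ℕ.% q ≢ 0 → ¬ pow ω a ≈ 1#
    ω^≉1 a a≢0 ω^a≈1 = ω-primitive (a ℕ.% q) (ℕ.n≢0⇒n>0 a≢0) (m%n<n a q) (trans (sym (pow-%-periodic q ω^q≈1 a)) ω^a≈1)

    ω^h≈-1 : pow ω h ≈ - 1#
    ω^h≈-1 with x*x≈1⇒x≈±1 (trans (sym (pow-+ ω h h)) (trans (reflexive (≡.cong (pow ω) h+h≡q)) ω^q≈1))
    ... | inj₁ ω^h≈1  = ⊥-elim (ω-primitive h 0<h h<q ω^h≈1)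
    ... | inj₂ ω^h≈-1 = ω^h≈-1

    -1≉1 : ¬ - 1# ≈ 1#
    -1≉1 -1≈1 = ω-primitive h 0<h h<q (trans ω^h≈-1 -1≈1)

    ≡ᵇ0-false : ∀ {a} → ¬ a ≋ 0 → (a ℕ.% p ≡ᵇ 0) ≡ false
    ≡ᵇ0-false {a} a≉0 with a ℕ.% p ≡ᵇ 0 in test
    ... | false = ≡.refl
    ... | true  = ⊥-elim (a≉0 (mk≋ (ℕ.≡ᵇ⇒≡ _ 0 (≡.subst T (≡.sym test) _))))

    char-≋0 : ∀ j {a} → a ≋ 0 → char j a ≈ 0#
    char-≋0 j (mk≋ a%p≡0) rewrite a%p≡0 = refl

    char-unit : ∀ j {a} → ¬ a ≋ 0 → char j a ≈ pow ω (j ℕ.* log a)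
    char-unit j a≉0 rewrite ≡ᵇ0-false a≉0 = refl

    char-resp : ∀ j → char j Preserves _≋_ ⟶ _≈_
    char-resp j (mk≋ a≡b) = reflexive
      (≡.cong (λ r → if r ≡ᵇ 0 then 0# else pow ω (j ℕ.* firstSat (λ i → (g ℕ.^ i) ℕ.% p ≡ᵇ r) (upTo q))) a≡b)

    char-* : ∀ j a b → char j (a ℕ.* b) ≈ char j a * char j b
    char-* j a b with a ≋? 0 | b ≋? 0
    ... | yes a≋0 | _ = begin
      char j (a ℕ.* b)       ≈⟨ char-≋0 j (*-≋0ˡ b a≋0) ⟩
      0#                     ≈⟨ zeroˡ _ ⟨
      0# * char j b          ≈⟨ *-congʳ (char-≋0 j a≋0) ⟨
      char j a * char j b    ∎
    ... | no _ | yes b≋0 = begin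
      char j (a ℕ.* b)       ≈⟨ char-≋0 j (*-≋0ʳ a b≋0) ⟩
      0#                     ≈⟨ zeroʳ _ ⟨
      char j a * 0#          ≈⟨ *-congˡ (char-≋0 j b≋0) ⟨
      char j a * char j b    ∎
    ... | no a≉0 | no b≉0 = begin
      char j (a ℕ.* b)                          ≈⟨ char-unit j (*-≉0 a≉0 b≉0) ⟩
      pow ω (j ℕ.* log (a ℕ.* b))               ≈⟨ ω^-cong (j ℕ.* log (a ℕ.* b)) (j ℕ.* (log a ℕ.+ log b)) (*-%-congˡ j {log (a ℕ.* b)} {log a ℕ.+ log b} (log-* a≉0 b≉0)) ⟩
      pow ω (j ℕ.* (log a ℕ.+ log b))           ≡⟨ ≡.cong (pow ω) (ℕ.*-distribˡ-+ j (log a) (log b)) ⟩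
      pow ω (j ℕ.* log a ℕ.+ j ℕ.* log b)       ≈⟨ pow-+ ω (j ℕ.* log a) (j ℕ.* log b) ⟩
      pow ω (j ℕ.* log a) * pow ω (j ℕ.* log b) ≈⟨ *-cong (char-unit j a≉0) (char-unit j b≉0) ⟨
      char j a * char j b                       ∎

    char-+ : ∀ i j a → char (i ℕ.+ j) a ≈ char i a * char j a
    char-+ i j a with a ≋? 0
    ... | yes a≋0 = begin
      char (i ℕ.+ j) a     ≈⟨ char-≋0 (i ℕ.+ j) a≋0 ⟩
      0#                   ≈⟨ zeroˡ _ ⟨
      0# * char j a        ≈⟨ *-congʳ (char-≋0 i a≋0) ⟨
      char i a * char j a  ∎
    ... | no a≉0 = begin
      char (i ℕ.+ j) a                           ≈⟨ char-unit (i ℕ.+ j) a≉0 ⟩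
      pow ω ((i ℕ.+ j) ℕ.* log a)                ≡⟨ ≡.cong (pow ω) (ℕ.*-distribʳ-+ (log a) i j) ⟩
      pow ω (i ℕ.* log a ℕ.+ j ℕ.* log a)        ≈⟨ pow-+ ω (i ℕ.* log a) (j ℕ.* log a) ⟩
      pow ω (i ℕ.* log a) * pow ω (j ℕ.* log a)  ≈⟨ *-cong (char-unit i a≉0) (char-unit j a≉0) ⟨
      char i a * char j a                        ∎

    char-^ : ∀ e j a → e ≢ 0 → char (e ℕ.* j) a ≈ char j (a ℕ.^ e)
    char-^ e j a e≢0 with a ≋? 0
    ... | yes a≋0 = trans (char-≋0 (e ℕ.* j) a≋0) (sym (char-≋0 j (^-≋0 e e≢0 a≋0)))
    ... | no a≉0  = begin
      char (e ℕ.* j) a             ≈⟨ char-unit (e ℕ.* j) a≉0 ⟩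
      pow ω (e ℕ.* j ℕ.* log a)    ≡⟨ ≡.cong (pow ω) (ℕ.*-assoc e j (log a)) ⟩
      pow ω (e ℕ.* (j ℕ.* log a))  ≡⟨ ≡.cong (pow ω) (ℕ.*-comm e (j ℕ.* log a)) ⟩
      pow ω (j ℕ.* log a ℕ.* e)    ≡⟨ ≡.cong (pow ω) (ℕ.*-assoc j (log a) e) ⟩
      pow ω (j ℕ.* (log a ℕ.* e))  ≡⟨ ≡.cong (λ x → pow ω (j ℕ.* x)) (ℕ.*-comm (log a) e) ⟩
      pow ω (j ℕ.* (e ℕ.* log a))  ≈⟨ ω^-cong (j ℕ.* (e ℕ.* log a)) (j ℕ.* log (a ℕ.^ e)) (*-%-congˡ j {e ℕ.* log a} {log (a ℕ.^ e)} (≡.sym (log-^ a≉0 e))) ⟩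
      pow ω (j ℕ.* log (a ℕ.^ e))  ≈⟨ char-unit j (^-≉0 e a≉0) ⟨
      char j (a ℕ.^ e)             ∎

    char-trivial : ∀ j {a} → j ℕ.% q ≡ 0 → ¬ a ≋ 0 → char j a ≈ 1#
    char-trivial j {a} j≡0 a≉0 = begin
      char j a              ≈⟨ char-unit j a≉0 ⟩
      pow ω (j ℕ.* log a)   ≈⟨ ω^-cong (j ℕ.* log a) 0 (*-%-congʳ (log a) {j} {0} j≡0) ⟩
      1#                    ∎

    char-1 : ∀ j → char j 1 ≈ 1#
    char-1 j = begin
      char j 1              ≈⟨ char-unit j 1≉0 ⟩
      pow ω (j ℕ.* log 1)   ≈⟨ ω^-cong (j ℕ.* log 1) 0 (≡.trans (*-%-congˡ j {log 1} {0} log-1) (≡.cong (ℕ._% q) (ℕ.*-zeroʳ j))) ⟩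
      1#                    ∎

    char-g : ∀ j → char j g ≈ pow ω j
    char-g j = begin
      char j g              ≈⟨ char-unit j g≉0 ⟩
      pow ω (j ℕ.* log g)   ≈⟨ ω^-cong (j ℕ.* log g) j (≡.trans (*-%-congˡ j {log g} {1} log-g) (≡.cong (ℕ._% q) (ℕ.*-identityʳ j))) ⟩
      pow ω j               ∎

    δ-trivial : ∀ j → j ℕ.% q ≡ 0 → δ j ≈ 1#
    δ-trivial j j≡0 rewrite j≡0 = refl

    δ-nontrivial : ∀ j → j ℕ.% q ≢ 0 → δ j ≈ 0#
    δ-nontrivial j j≢0 with j ℕ.% q
    ... | zero  = ⊥-elim (j≢0 ≡.refl)
    ... | suc _ = refl

    sum-indicator : ∀ c {f} → f Preserves _≋_ ⟶ _≈_ → sumTo p (λ x → [ x ≋? c ] * f x) ≈ f c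
    sum-indicator c {f} f-resp = begin
      sumTo p (λ x → [ x ≋? c ] * f x)            ≈⟨ sum-cong< p (λ x x<p → *-congʳ ([]-cong (x ≋? c) (x ℕ.≟ c ℕ.% p) (to x<p) (from x<p))) ⟩
      sumTo p (λ x → [ x ℕ.≟ c ℕ.% p ] * f x)     ≈⟨ sum-delta p f (m%n<n c p) ⟩
      f (c ℕ.% p)                                 ≈⟨ f-resp (%p≋ c) ⟩
      f c                                         ∎
      where
      to : ∀ {x} → x < p → x ≋ c → x ≡ c ℕ.% p
      to x<p (mk≋ x≡c) = ≡.trans (≡.sym (m<n⇒m%n≡m x<p)) x≡c
      from : ∀ {x} → x < p → x ≡ c ℕ.% p → x ≋ c
      from x<p x≡c = mk≋ (≡.trans (m<n⇒m%n≡m x<p) x≡c)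

    sum-reindex : ∀ {f} (σ τ : ℕ → ℕ) → f Preserves _≋_ ⟶ _≈_ →
                  σ Preserves _≋_ ⟶ _≋_ → τ Preserves _≋_ ⟶ _≋_ →
                  (∀ y → σ (τ y) ≋ y) → (∀ x → τ (σ x) ≋ x) →
                  sumTo p (λ x → f (σ x)) ≈ sumTo p f
    sum-reindex {f} σ τ f-resp σ-resp τ-resp στ≋id τσ≋id = begin
      sumTo p (λ x → f (σ x))                               ≈⟨ sum-cong p (λ x → sum-indicator (σ x) f-resp) ⟨
      sumTo p (λ x → sumTo p (λ y → [ y ≋? σ x ] * f y))    ≈⟨ sum-swap p p _ ⟩
      sumTo p (λ y → sumTo p (λ x → [ y ≋? σ x ] * f y))    ≈⟨ sum-cong p (λ y → sum-cong p (λ x → *-congʳ ([]-cong (y ≋? σ x) (x ≋? τ y) (to x y) (from x y)))) ⟩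
      sumTo p (λ y → sumTo p (λ x → [ x ≋? τ y ] * f y))    ≈⟨ sum-cong p (λ y → sum-indicator (τ y) (λ _ → refl)) ⟩
      sumTo p f                                             ∎
      where
      to : ∀ x y → y ≋ σ x → x ≋ τ y
      to x y y≋σx = ≋-trans (≋-sym (τσ≋id x)) (τ-resp (≋-sym y≋σx))
      from : ∀ x y → x ≋ τ y → y ≋ σ x
      from x y x≋τy = ≋-trans (≋-sym (στ≋id y)) (σ-resp (≋-sym x≋τy))

    sum-affine : ∀ {f} c b → ¬ c ≋ 0 → f Preserves _≋_ ⟶ _≈_ → sumTo p (λ x → f (c ℕ.* x ℕ.+ b)) ≈ sumTo p f
    sum-affine c b c≉0 f-resp = sum-reindex (affine c b) (affine⁻¹ c b) f-resp
      (λ x≋y → +-≋ʳ b (*-≋ˡ c x≋y)) (λ x≋y → *-≋ˡ (c ℕ.^ k) (+-≋ʳ _ x≋y))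
      (affine-inverseˡ b c≉0) (affine-inverseʳ b c≉0)

    sum-scale : ∀ {f} c → ¬ c ≋ 0 → f Preserves _≋_ ⟶ _≈_ → sumTo p (λ x → f (c ℕ.* x)) ≈ sumTo p f
    sum-scale c c≉0 f-resp =
      trans (sum-cong p (λ x → f-resp (≡⇒≋ (≡.sym (ℕ.+-identityʳ (c ℕ.* x)))))) (sum-affine c 0 c≉0 f-resp)

    sum-translate : ∀ {f} b → f Preserves _≋_ ⟶ _≈_ → sumTo p (λ x → f (x ℕ.+ b)) ≈ sumTo p f
    sum-translate b f-resp =
      trans (sum-cong p (λ x → f-resp (≡⇒≋ (≡.cong (ℕ._+ b) (≡.sym (ℕ.*-identityˡ x)))))) (sum-affine 1 b 1≉0 f-resp)

    sum-^k : ∀ {f} → f Preserves _≋_ ⟶ _≈_ → sumTo p (λ x → f (x ℕ.^ k)) ≈ sumTo p f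
    sum-^k f-resp = sum-reindex (ℕ._^ k) (ℕ._^ k) f-resp (^-≋ k) (^-≋ k) [a^k]^k≋a [a^k]^k≋a

    orthogonality : ∀ y → sumTo q (λ j → char j y) ≈ fromℕ q * [ y ≋? 1 ]
    orthogonality y with y ≋? 0 | y ≋? 1
    ... | yes y≋0 | yes y≋1 = ⊥-elim (1≉0 (≋-trans (≋-sym y≋1) y≋0))
    ... | yes y≋0 | no _    = trans (sum-zero q (λ j _ → char-≋0 j y≋0)) (sym (zeroʳ _))
    ... | no _    | yes y≋1 =
      trans (sum-cong q (λ j → trans (char-resp j y≋1) (char-1 j))) (trans (sum-1# q) (sym (*-identityʳ _)))
    ... | no y≉0  | no y≉1  = trans (x*y≈y⇒y≈0 w≉1 w*S≈S) (sym (zeroʳ _))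
      where
      w : Carrier
      w = pow ω (log y)
      S≈ : sumTo q (λ j → char j y) ≈ sumTo q (pow w)
      S≈ = sum-cong q (λ j → trans (char-unit j y≉0)
             (trans (reflexive (≡.cong (pow ω) (ℕ.*-comm j (log y)))) (pow-* ω (log y) j)))
      w^q≈1 : pow w q ≈ 1#
      w^q≈1 = trans (sym (pow-* ω (log y) q)) (ω^-cong (log y ℕ.* q) 0 (m*n%n≡0 (log y) q))
      w*S≈S : w * sumTo q (λ j → char j y) ≈ sumTo q (λ j → char j y)
      w*S≈S = trans (*-congˡ S≈)
                (trans (∙-cancelʳ 1# _ _ (trans (geometric-sum w q) (+-congˡ w^q≈1))) (sym S≈))
      w≉1 : ¬ w ≈ 1#
      w≉1 = ω^≉1 (log y) (λ log≡0 → y≉1 (≋-trans (≋-sym (g^log y≉0)) (≡⇒≋ (≡.cong (g ℕ.^_)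
              (≡.trans (≡.sym (m<n⇒m%n≡m (proj₁ (log-spec y≉0)))) log≡0)))))

    sum-char : ∀ j → sumTo p (char j) ≈ fromℕ q * δ j
    sum-char j with j ℕ.% q ℕ.≟ 0
    ... | yes j%q = begin
      sumTo p (char j)                          ≈⟨ sum-head q (char j) ⟩
      char j 0 + sumTo q (λ x → char j (suc x)) ≈⟨ +-cong (char-≋0 j ≋-refl) (sum-cong< q (λ x x<q → char-trivial j j%q (suc-≉0 (s≤s x<q)))) ⟩
      0# + sumTo q (λ _ → 1#)                   ≈⟨ +-identityˡ _ ⟩
      sumTo q (λ _ → 1#)                        ≈⟨ sum-1# q ⟩
      fromℕ q                                   ≈⟨ *-identityʳ _ ⟨
      fromℕ q * 1#                              ≈⟨ *-congˡ (δ-trivial j j%q) ⟨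
      fromℕ q * δ j                             ∎
    ... | no j%q≢0 = trans (x*y≈y⇒y≈0 χ[g]≉1 χ[g]*S≈S) (sym (trans (*-congˡ (δ-nontrivial j j%q≢0)) (zeroʳ _)))
      where
      χ[g]≉1 : ¬ char j g ≈ 1#
      χ[g]≉1 χ[g]≈1 = ω^≉1 j j%q≢0 (trans (sym (char-g j)) χ[g]≈1)
      χ[g]*S≈S : char j g * sumTo p (char j) ≈ sumTo p (char j)
      χ[g]*S≈S = begin
        char j g * sumTo p (char j)             ≈⟨ sum-distribˡ p (char j g) (char j) ⟩
        sumTo p (λ x → char j g * char j x)     ≈⟨ sum-cong p (λ x → char-* j g x) ⟨
        sumTo p (λ x → char j (g ℕ.* x))        ≈⟨ sum-scale g g≉0 (char-resp j) ⟩
        sumTo p (char j)                        ∎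

    φ : ℕ → Carrier
    φ = char h

    sum-φ : sumTo p φ ≈ 0#
    sum-φ = trans (sum-char h) (trans (*-congˡ (δ-nontrivial h h%q≢0)) (zeroʳ _))
      where
      h%q≢0 : h ℕ.% q ≢ 0
      h%q≢0 h%q≡0 = ℕ.<⇒≢ 0<h (≡.sym (≡.trans (≡.sym (m<n⇒m%n≡m h<q)) h%q≡0))

    φ² : ∀ {a} → ¬ a ≋ 0 → φ a * φ a ≈ 1#
    φ² {a} a≉0 = trans (sym (char-+ h h a)) (char-trivial (h ℕ.+ h) (≡.trans (≡.cong (ℕ._% q) h+h≡q) (n%n≡0 q)) a≉0)

    φ-^k : ∀ a → φ (a ℕ.^ k) ≈ φ a
    φ-^k a with a ≋? 0
    ... | yes a≋0 = trans (char-≋0 h (^-≋0 k k≢0 a≋0)) (sym (char-≋0 h a≋0))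
    ... | no a≉0 = begin
      φ (a ℕ.^ k)                    ≈⟨ *-identityʳ _ ⟨
      φ (a ℕ.^ k) * 1#               ≈⟨ *-congˡ (φ² a≉0) ⟨
      φ (a ℕ.^ k) * (φ a * φ a)      ≈⟨ *-assoc _ _ _ ⟨
      (φ (a ℕ.^ k) * φ a) * φ a      ≈⟨ *-congʳ (char-* h (a ℕ.^ k) a) ⟨
      φ (a ℕ.^ k ℕ.* a) * φ a        ≈⟨ *-congʳ (char-resp h (a^k*a≋1 a≉0)) ⟩
      φ 1 * φ a                      ≈⟨ *-congʳ (char-1 h) ⟩
      1# * φ a                       ≈⟨ *-identityˡ _ ⟩
      φ a                            ∎

    e : ℕ → Carrier
    e = pow ζ

    e-resp : e Preserves _≋_ ⟶ _≈_
    e-resp {a} {b} (mk≋ a≡b) =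
      trans (pow-%-periodic p ζ^p≈1 a) (trans (reflexive (≡.cong e a≡b)) (sym (pow-%-periodic p ζ^p≈1 b)))

    e-+ : ∀ a b → e (a ℕ.+ b) ≈ e a * e b
    e-+ = pow-+ ζ

    twisted-gauss : ∀ L → sumTo p (λ d → φ d * e (d ℕ.* L)) ≈ φ L * gauss h
    twisted-gauss L with L ≋? 0
    ... | yes L≋0 = begin
      sumTo p (λ d → φ d * e (d ℕ.* L))   ≈⟨ sum-cong p (λ d → trans (*-congˡ (e-resp (*-≋0ʳ d L≋0))) (*-identityʳ _)) ⟩
      sumTo p φ                           ≈⟨ sum-φ ⟩
      0#                                  ≈⟨ zeroˡ _ ⟨
      0# * gauss h                        ≈⟨ *-congʳ (char-≋0 h L≋0) ⟨
      φ L * gauss h                       ∎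
    ... | no L≉0 = begin
      sumTo p (λ d → φ d * e (d ℕ.* L))                            ≈⟨ sum-scale (L ℕ.^ k) (^-≉0 k L≉0) resp ⟨
      sumTo p (λ u → φ (L ℕ.^ k ℕ.* u) * e (L ℕ.^ k ℕ.* u ℕ.* L))  ≈⟨ sum-cong p (λ u → *-cong (char-* h (L ℕ.^ k) u) (e-resp (a^k*b*a≋b L≉0 u))) ⟩
      sumTo p (λ u → (φ (L ℕ.^ k) * φ u) * e u)                    ≈⟨ sum-cong p (λ u → trans (*-congʳ (*-congʳ (φ-^k L))) (*-assoc _ _ _)) ⟩
      sumTo p (λ u → φ L * (φ u * e u))                            ≈⟨ sum-distribˡ p (φ L) _ ⟨
      φ L * gauss h                                                ∎
      where
      resp : (λ d → φ d * e (d ℕ.* L)) Preserves _≋_ ⟶ _≈_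
      resp x≋y = *-cong (char-resp h x≋y) (e-resp (*-≋ʳ L x≋y))

    sum-indicator-1# : ∀ c → sumTo p (λ x → [ x ≋? c ]) ≈ 1#
    sum-indicator-1# c = trans (sum-cong p (λ x → sym (*-identityʳ _))) (sum-indicator c {λ _ → 1#} (λ _ → refl))

    φ[a*a] : ∀ {a} → ¬ a ≋ 0 → φ (a ℕ.* a) ≈ 1#
    φ[a*a] {a} a≉0 = trans (char-* h a a) (φ² a≉0)

    odd-log⇒φ≈-1 : ∀ {z} s → ¬ z ≋ 0 → log z ≡ suc (s ℕ.+ s) → φ z ≈ - 1#
    odd-log⇒φ≈-1 {z} s z≉0 log≡1+s+s = begin
      φ z                                ≈⟨ char-unit h z≉0 ⟩
      pow ω (h ℕ.* log z)                ≡⟨ ≡.cong (λ l → pow ω (h ℕ.* l)) log≡1+s+s ⟩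
      pow ω (h ℕ.* suc (s ℕ.+ s))        ≈⟨ ω^-cong (h ℕ.* suc (s ℕ.+ s)) h (h*[1+s+s]%q≡h%q s) ⟩
      pow ω h                            ≈⟨ ω^h≈-1 ⟩
      - 1#                               ∎

    [y²≋y₀²]≈[y≋y₀]+[y≋-y₀] : ∀ {y₀} → ¬ y₀ ≋ 0 → ∀ y →
                              [ y ℕ.* y ≋? y₀ ℕ.* y₀ ] ≈ [ y ≋? y₀ ] + [ y ≋? q ℕ.* y₀ ]
    [y²≋y₀²]≈[y≋y₀]+[y≋-y₀] {y₀} y₀≉0 y with y ≋? y₀ | y ≋? q ℕ.* y₀ | y ℕ.* y ≋? y₀ ℕ.* y₀
    ... | yes y≋y₀ | yes y≋-y₀ | _      = ⊥-elim (y₀≉0 (≋q*⇒≋0 (≋-trans (≋-sym y≋y₀) y≋-y₀)))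
    ... | yes _    | no _      | yes _  = sym (+-identityʳ 1#)
    ... | yes y≋y₀ | no _      | no y²≉ = ⊥-elim (y²≉ (*-≋ y≋y₀ y≋y₀))
    ... | no _     | yes _     | yes _  = sym (+-identityˡ 1#)
    ... | no _     | yes y≋-y₀ | no y²≉ = ⊥-elim (y²≉ (≋-trans (*-≋ y≋-y₀ y≋-y₀) ([q*a]*[q*a]≋a*a y₀)))
    ... | no y≉y₀  | no y≉-y₀  | yes y²≋ with square-roots y²≋
    ...   | inj₁ y≋y₀  = ⊥-elim (y≉y₀ y≋y₀)
    ...   | inj₂ y≋-y₀ = ⊥-elim (y≉-y₀ y≋-y₀)
    [y²≋y₀²]≈[y≋y₀]+[y≋-y₀] _ _ | no _ | no _ | no _ = sym (+-identityˡ 0#)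

    sum-[y²≋y₀²] : ∀ {y₀} → ¬ y₀ ≋ 0 → sumTo p (λ y → [ y ℕ.* y ≋? y₀ ℕ.* y₀ ]) ≈ 1# + 1#
    sum-[y²≋y₀²] {y₀} y₀≉0 = begin
      sumTo p (λ y → [ y ℕ.* y ≋? y₀ ℕ.* y₀ ])                          ≈⟨ sum-cong p ([y²≋y₀²]≈[y≋y₀]+[y≋-y₀] y₀≉0) ⟩
      sumTo p (λ y → [ y ≋? y₀ ] + [ y ≋? q ℕ.* y₀ ])                  ≈⟨ sum-+ p _ _ ⟩
      sumTo p (λ y → [ y ≋? y₀ ]) + sumTo p (λ y → [ y ≋? q ℕ.* y₀ ])  ≈⟨ +-cong (sum-indicator-1# y₀) (sum-indicator-1# (q ℕ.* y₀)) ⟩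
      1# + 1#                                                           ∎

    squares-count : ∀ z → sumTo p (λ y → [ y ℕ.* y ≋? z ]) ≈ 1# + φ z
    squares-count z with z ≋? 0
    ... | yes z≋0 = begin
      sumTo p (λ y → [ y ℕ.* y ≋? z ])  ≈⟨ sum-cong p (λ y → []-cong (y ℕ.* y ≋? z) (y ≋? 0) (y²≋0⇒y≋0 y) (y≋0⇒y²≋0 y)) ⟩
      sumTo p (λ y → [ y ≋? 0 ])        ≈⟨ sum-indicator-1# 0 ⟩
      1#                                ≈⟨ +-identityʳ 1# ⟨
      1# + 0#                           ≈⟨ +-congˡ (char-≋0 h z≋0) ⟨
      1# + φ z                          ∎
      where
      y²≋0⇒y≋0 : ∀ y → y ℕ.* y ≋ z → y ≋ 0
      y²≋0⇒y≋0 y y²≋z with *≋0⇒ (≋-trans y²≋z z≋0)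
      ... | inj₁ y≋0 = y≋0
      ... | inj₂ y≋0 = y≋0
      y≋0⇒y²≋0 : ∀ y → y ≋ 0 → y ℕ.* y ≋ z
      y≋0⇒y²≋0 y y≋0 = ≋-trans (*-≋0ˡ y y≋0) (≋-sym z≋0)
    ... | no z≉0 with even-or-odd (log z)
    ...   | s , inj₁ log≡s+s = begin
      sumTo p (λ y → [ y ℕ.* y ≋? z ])          ≈⟨ sum-cong p (λ y → []-cong (y ℕ.* y ≋? z) (y ℕ.* y ≋? y₀ ℕ.* y₀) (λ e → ≋-trans e (≋-sym y₀²≋z)) (λ e → ≋-trans e y₀²≋z)) ⟩
      sumTo p (λ y → [ y ℕ.* y ≋? y₀ ℕ.* y₀ ])  ≈⟨ sum-[y²≋y₀²] (^-≉0 s g≉0) ⟩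
      1# + 1#                                   ≈⟨ +-congˡ (trans (char-resp h (≋-sym y₀²≋z)) (φ[a*a] (^-≉0 s g≉0))) ⟨
      1# + φ z                                  ∎
      where
      y₀ : ℕ
      y₀ = g ℕ.^ s
      y₀²≋z : y₀ ℕ.* y₀ ≋ z
      y₀²≋z = ≋-trans (≡⇒≋ (≡.trans (≡.sym (ℕ.^-distribˡ-+-* g s s)) (≡.cong (g ℕ.^_) (≡.sym log≡s+s)))) (g^log z≉0)
    ...   | s , inj₂ log≡1+s+s = begin
      sumTo p (λ y → [ y ℕ.* y ≋? z ])   ≈⟨ sum-zero p (λ y _ → []-no (y ℕ.* y ≋? z) (not-a-square y)) ⟩
      0#                                 ≈⟨ -‿inverseʳ 1# ⟨
      1# - 1#                            ≈⟨ +-congˡ (odd-log⇒φ≈-1 s z≉0 log≡1+s+s) ⟨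
      1# + φ z                           ∎
      where
      not-a-square : ∀ y → ¬ y ℕ.* y ≋ z
      not-a-square y y²≋z with y ≋? 0
      ... | yes y≋0 = z≉0 (≋-trans (≋-sym y²≋z) (*-≋0ˡ y y≋0))
      ... | no y≉0  = -1≉1 (trans (sym (odd-log⇒φ≈-1 s z≉0 log≡1+s+s)) (trans (char-resp h (≋-sym y²≋z)) (φ[a*a] y≉0)))

    sum-squares : ∀ {f} → f Preserves _≋_ ⟶ _≈_ → sumTo p (λ y → f (y ℕ.* y)) ≈ sumTo p (λ z → (1# + φ z) * f z)
    sum-squares {f} f-resp = begin
      sumTo p (λ y → f (y ℕ.* y))                              ≈⟨ sum-cong p (λ y → sum-indicator (y ℕ.* y) f-resp) ⟨
      sumTo p (λ y → sumTo p (λ z → [ z ≋? y ℕ.* y ] * f z))  ≈⟨ sum-swap p p _ ⟩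
      sumTo p (λ z → sumTo p (λ y → [ z ≋? y ℕ.* y ] * f z))  ≈⟨ sum-cong p (λ z → sum-cong p (λ y → *-congʳ ([]-cong (z ≋? y ℕ.* y) (y ℕ.* y ≋? z) ≋-sym ≋-sym))) ⟩
      sumTo p (λ z → sumTo p (λ y → [ y ℕ.* y ≋? z ] * f z))  ≈⟨ sum-cong p (λ z → sum-distribʳ p (f z) _) ⟨
      sumTo p (λ z → sumTo p (λ y → [ y ℕ.* y ≋? z ]) * f z)  ≈⟨ sum-cong p (λ z → *-congʳ (squares-count z)) ⟩
      sumTo p (λ z → (1# + φ z) * f z)                         ∎

    sum-φ[y²] : sumTo p (λ y → φ (y ℕ.* y)) ≈ fromℕ q
    sum-φ[y²] = begin
      sumTo p (λ y → φ (y ℕ.* y))   ≈⟨ sum-cong p φ[y²]≈ε ⟩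
      sumTo p (char 0)              ≈⟨ sum-char 0 ⟩
      fromℕ q * δ 0                 ≈⟨ *-congˡ (δ-trivial 0 ≡.refl) ⟩
      fromℕ q * 1#                  ≈⟨ *-identityʳ _ ⟩
      fromℕ q                       ∎
      where
      φ[y²]≈ε : ∀ y → φ (y ℕ.* y) ≈ char 0 y
      φ[y²]≈ε y with y ≋? 0
      ... | yes y≋0 = trans (char-≋0 h (*-≋0ˡ y y≋0)) (sym (char-≋0 0 y≋0))
      ... | no y≉0  = trans (φ[a*a] y≉0) (sym (char-trivial 0 ≡.refl y≉0))

    φ[z]φ[z+c] : ∀ c z → φ z * φ (z ℕ.+ c) ≈ φ (c ℕ.* z ℕ.^ k ℕ.+ 1) - [ z ≋? 0 ]
    φ[z]φ[z+c] c z with z ≋? 0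
    ... | yes z≋0 = begin
      φ z * φ (z ℕ.+ c)                ≈⟨ *-congʳ (char-≋0 h z≋0) ⟩
      0# * φ (z ℕ.+ c)                 ≈⟨ zeroˡ _ ⟩
      0#                               ≈⟨ -‿inverseʳ 1# ⟨
      1# - 1#                          ≈⟨ +-congʳ (trans (char-resp h c*z^k+1≋1) (char-1 h)) ⟨
      φ (c ℕ.* z ℕ.^ k ℕ.+ 1) - 1#     ∎
      where
      c*z^k+1≋1 : c ℕ.* z ℕ.^ k ℕ.+ 1 ≋ 1
      c*z^k+1≋1 = +-≋ʳ 1 (*-≋0ʳ c (^-≋0 k k≢0 z≋0))
    ... | no z≉0 = begin
      φ z * φ (z ℕ.+ c)                            ≈⟨ char-* h z (z ℕ.+ c) ⟨
      φ (z ℕ.* (z ℕ.+ c))                          ≈⟨ char-resp h (z[z+c]≋z²[c*z^k+1] c z≉0) ⟩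
      φ (z ℕ.* z ℕ.* (c ℕ.* z ℕ.^ k ℕ.+ 1))        ≈⟨ char-* h (z ℕ.* z) _ ⟩
      φ (z ℕ.* z) * φ (c ℕ.* z ℕ.^ k ℕ.+ 1)        ≈⟨ *-congʳ (φ[a*a] z≉0) ⟩
      1# * φ (c ℕ.* z ℕ.^ k ℕ.+ 1)                 ≈⟨ *-identityˡ _ ⟩
      φ (c ℕ.* z ℕ.^ k ℕ.+ 1)                      ≈⟨ +-identityʳ _ ⟨
      φ (c ℕ.* z ℕ.^ k ℕ.+ 1) + 0#                 ≈⟨ +-congˡ ε⁻¹≈ε ⟨
      φ (c ℕ.* z ℕ.^ k ℕ.+ 1) - 0#                 ∎

    -- Dividing by z², the terms φ(z(z - D)) become φ(1 - D/z), and 1 - D/z runs over every value except 1.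
    sum-φ[z]φ[z-D] : ∀ {D} → ¬ D ≋ 0 → sumTo p (λ z → φ z * φ (z ℕ.+ q ℕ.* D)) ≈ - 1#
    sum-φ[z]φ[z-D] {D} D≉0 = begin
      sumTo p (λ z → φ z * φ (z ℕ.+ q ℕ.* D))                                 ≈⟨ sum-cong p (φ[z]φ[z+c] (q ℕ.* D)) ⟩
      sumTo p (λ z → φ (q ℕ.* D ℕ.* z ℕ.^ k ℕ.+ 1) - [ z ≋? 0 ])             ≈⟨ sum-+ p _ _ ⟩
      sumTo p (λ z → φ (q ℕ.* D ℕ.* z ℕ.^ k ℕ.+ 1)) + sumTo p (λ z → - [ z ≋? 0 ]) ≈⟨ +-cong sum-φ[-D/z+1] (trans (sum-neg p _) (-‿cong (sum-indicator-1# 0))) ⟩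
      0# - 1#                                                                ≈⟨ +-identityˡ _ ⟩
      - 1#                                                                   ∎
      where
      -D≉0 : ¬ q ℕ.* D ≋ 0
      -D≉0 = *-≉0 q≉0 D≉0
      sum-φ[-D/z+1] : sumTo p (λ z → φ (q ℕ.* D ℕ.* z ℕ.^ k ℕ.+ 1)) ≈ 0#
      sum-φ[-D/z+1] = begin
        sumTo p (λ z → φ (q ℕ.* D ℕ.* z ℕ.^ k ℕ.+ 1))  ≈⟨ sum-^k (λ x≋y → char-resp h (+-≋ʳ 1 (*-≋ˡ (q ℕ.* D) x≋y))) ⟩
        sumTo p (λ u → φ (q ℕ.* D ℕ.* u ℕ.+ 1))        ≈⟨ sum-affine (q ℕ.* D) 1 -D≉0 (char-resp h) ⟩
        sumTo p φ                                      ≈⟨ sum-φ ⟩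
        0#                                             ∎

    sum-φ[y²-D] : ∀ {D} → ¬ D ≋ 0 → sumTo p (λ y → φ (y ℕ.* y ℕ.+ q ℕ.* D)) ≈ - 1#
    sum-φ[y²-D] {D} D≉0 = begin
      sumTo p (λ y → φ (y ℕ.* y ℕ.+ q ℕ.* D))                                   ≈⟨ sum-squares (λ x≋y → char-resp h (+-≋ʳ (q ℕ.* D) x≋y)) ⟩
      sumTo p (λ z → (1# + φ z) * φ (z ℕ.+ q ℕ.* D))                            ≈⟨ sum-cong p (λ z → trans (distribʳ _ _ _) (+-congʳ (*-identityˡ _))) ⟩
      sumTo p (λ z → φ (z ℕ.+ q ℕ.* D) + φ z * φ (z ℕ.+ q ℕ.* D))               ≈⟨ sum-+ p _ _ ⟩
      sumTo p (λ z → φ (z ℕ.+ q ℕ.* D)) + sumTo p (λ z → φ z * φ (z ℕ.+ q ℕ.* D)) ≈⟨ +-cong (trans (sum-translate (q ℕ.* D) (char-resp h)) sum-φ) (sum-φ[z]φ[z-D] D≉0) ⟩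
      0# + - 1#                                                                 ≈⟨ +-identityˡ _ ⟩
      - 1#                                                                      ∎

    φ[4*a] : ∀ a → φ (4 ℕ.* a) ≈ φ a
    φ[4*a] a = trans (char-* h 4 a) (trans (*-congʳ (φ[a*a] 2≉0)) (*-identityˡ _))

    quadratic-char-sum : ∀ B A → sumTo p (λ β → φ (β ℕ.* β ℕ.+ B ℕ.* β ℕ.+ A)) ≈ fromℕ p * [ B ℕ.* B ≋? 4 ℕ.* A ] - 1#
    quadratic-char-sum B A = begin
      sumTo p (λ β → φ (β ℕ.* β ℕ.+ B ℕ.* β ℕ.+ A))                      ≈⟨ sum-cong p (λ β → φ[4*a] (β ℕ.* β ℕ.+ B ℕ.* β ℕ.+ A)) ⟨
      sumTo p (λ β → φ (4 ℕ.* (β ℕ.* β ℕ.+ B ℕ.* β ℕ.+ A)))              ≈⟨ sum-cong p (λ β → char-resp h (completing-square B A β)) ⟩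
      sumTo p (λ β → φ ((2 ℕ.* β ℕ.+ B) ℕ.* (2 ℕ.* β ℕ.+ B) ℕ.+ q ℕ.* D)) ≈⟨ sum-affine 2 B 2≉0 (λ x≋y → char-resp h (+-≋ʳ (q ℕ.* D) (*-≋ x≋y x≋y))) ⟩
      sumTo p (λ y → φ (y ℕ.* y ℕ.+ q ℕ.* D))                            ≈⟨ by-discriminant (B ℕ.* B ≋? 4 ℕ.* A) ⟩
      fromℕ p * [ B ℕ.* B ≋? 4 ℕ.* A ] - 1#                              ∎
      where
      D : ℕ
      D = B ℕ.* B ℕ.+ q ℕ.* (4 ℕ.* A)
      x≈[1+x]*1-1 : ∀ x → x ≈ (1# + x) * 1# - 1#
      x≈[1+x]*1-1 x = sym (begin
        (1# + x) * 1# - 1#     ≈⟨ +-congʳ (trans (*-identityʳ _) (+-comm 1# x)) ⟩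
        (x + 1#) - 1#          ≈⟨ +-assoc x 1# (- 1#) ⟩
        x + (1# - 1#)          ≈⟨ +-congˡ (-‿inverseʳ 1#) ⟩
        x + 0#                 ≈⟨ +-identityʳ x ⟩
        x                      ∎)
      by-discriminant : (B²≟4A : Dec (B ℕ.* B ≋ 4 ℕ.* A)) → sumTo p (λ y → φ (y ℕ.* y ℕ.+ q ℕ.* D)) ≈ fromℕ p * [ B²≟4A ] - 1#
      by-discriminant (yes B²≋4A) = begin
        sumTo p (λ y → φ (y ℕ.* y ℕ.+ q ℕ.* D))   ≈⟨ sum-cong p (λ y → char-resp h (≋-trans (+-≋ˡ (y ℕ.* y) (*-≋0ʳ q (≋⇒+q*≋0 B²≋4A))) (≡⇒≋ (ℕ.+-identityʳ _)))) ⟩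
        sumTo p (λ y → φ (y ℕ.* y))               ≈⟨ sum-φ[y²] ⟩
        fromℕ q                                   ≈⟨ x≈[1+x]*1-1 (fromℕ q) ⟩
        fromℕ p * 1# - 1#                         ∎
      by-discriminant (no B²≉4A) = begin
        sumTo p (λ y → φ (y ℕ.* y ℕ.+ q ℕ.* D))   ≈⟨ sum-φ[y²-D] (λ D≋0 → B²≉4A (+q*≋0⇒≋ D≋0)) ⟩
        - 1#                                      ≈⟨ +-identityˡ _ ⟨
        0# - 1#                                   ≈⟨ +-congʳ (zeroʳ _) ⟨
        fromℕ p * 0# - 1#                         ∎

    module MainIdentity (n : ℕ) (1≤n : 1 ≤ n) (α : ℕ) (p∤α : ¬ p ∣ α) where

      open PropositionArithmetic k prime odd g p∤g g-primitive n 1≤n α p∤α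

      ε : ℕ → Carrier
      ε = char 0

      ε-≋0 : ∀ {x} → x ≋ 0 → ε x ≈ 0#
      ε-≋0 = char-≋0 0

      ε-unit : ∀ {x} → ¬ x ≋ 0 → ε x ≈ 1#
      ε-unit = char-trivial 0 ≡.refl

      summand : ℕ → ℕ → ℕ → ℕ → ℕ → Carrier
      summand j a b c d = char (m ℕ.* j) a * e a * (char (h ℕ.+ k ℕ.* j) b * e b) * (char (k ℕ.* j) c * e c)
                          * (char (m₂ ℕ.* (k ℕ.* j)) d * e d) * char j α

      -- Since k ≡ -1 modulo q, the four characters of the summand combine to χ_j of K a b d · c ^ k.
      summand≈ : ∀ j a b c d → summand j a b c d ≈ (e a * e b * e c * e d * φ b) * char j (K a b d ℕ.* c ℕ.^ k)
      summand≈ j a b c d = begin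
        summand j a b c d
          ≈⟨ *-congʳ (*-cong (*-cong (*-cong (*-congʳ χa) (*-congʳ χb)) (*-congʳ χc)) (*-congʳ χd)) ⟩
        χ[a^m] * e a * (φ b * χ[b^k] * e b) * (χ[c^k] * e c) * (χ[d^m₂k] * e d) * char j α
          ≈⟨ solve 10 (λ χa ea φb χb eb χc ec χd ed χα →
               χa :* ea :* (φb :* χb :* eb) :* (χc :* ec) :* (χd :* ed) :* χα :=
               (ea :* eb :* ec :* ed :* φb) :* (χa :* χb :* χd :* χα :* χc)) refl
               χ[a^m] (e a) (φ b) χ[b^k] (e b) χ[c^k] (e c) χ[d^m₂k] (e d) (char j α) ⟩
        (e a * e b * e c * e d * φ b) * (χ[a^m] * χ[b^k] * χ[d^m₂k] * char j α * χ[c^k])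
          ≈⟨ *-congˡ (sym χ[Kc^k]) ⟩
        (e a * e b * e c * e d * φ b) * char j (K a b d ℕ.* c ℕ.^ k)
          ∎
        where
        χ[a^m] = char j (a ℕ.^ m)
        χ[b^k] = char j (b ℕ.^ k)
        χ[c^k] = char j (c ℕ.^ k)
        χ[d^m₂k] = char j (d ℕ.^ (m₂ ℕ.* k))
        χa : char (m ℕ.* j) a ≈ χ[a^m]
        χa = char-^ m j a m≢0
        χb : char (h ℕ.+ k ℕ.* j) b ≈ φ b * χ[b^k]
        χb = trans (char-+ h (k ℕ.* j) b) (*-congˡ (char-^ k j b k≢0))
        χc : char (k ℕ.* j) c ≈ χ[c^k]
        χc = char-^ k j c k≢0
        χd : char (m₂ ℕ.* (k ℕ.* j)) d ≈ χ[d^m₂k]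
        χd = trans (reflexive (≡.cong (λ i → char i d) (≡.sym (ℕ.*-assoc m₂ k j)))) (char-^ (m₂ ℕ.* k) j d m₂*k≢0)
        χ[Kc^k] : char j (K a b d ℕ.* c ℕ.^ k) ≈ χ[a^m] * χ[b^k] * χ[d^m₂k] * char j α * χ[c^k]
        χ[Kc^k] = trans (char-* j (K a b d) (c ℕ.^ k))
                    (*-congʳ (trans (char-* j (a ℕ.^ m ℕ.* b ℕ.^ k ℕ.* d ℕ.^ (m₂ ℕ.* k)) α)
                      (*-congʳ (trans (char-* j (a ℕ.^ m ℕ.* b ℕ.^ k) (d ℕ.^ (m₂ ℕ.* k)))
                        (*-congʳ (char-* j (a ℕ.^ m) (b ℕ.^ k)))))))

      sum-over-c : ∀ x → sumTo p (λ c → [ x ℕ.* c ℕ.^ k ≋? 1 ] * e c) ≈ ε x * e x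
      sum-over-c x with x ≋? 0
      ... | yes x≋0 = begin
        sumTo p (λ c → [ x ℕ.* c ℕ.^ k ≋? 1 ] * e c)   ≈⟨ sum-zero p (λ c _ → trans (*-congʳ ([]-no (x ℕ.* c ℕ.^ k ≋? 1) (xc^k≉1 c))) (zeroˡ _)) ⟩
        0#                                             ≈⟨ zeroˡ _ ⟨
        0# * e x                                       ≈⟨ *-congʳ (ε-≋0 x≋0) ⟨
        ε x * e x                                      ∎
        where
        xc^k≉1 : ∀ c → ¬ x ℕ.* c ℕ.^ k ≋ 1
        xc^k≉1 c xc^k≋1 = 1≉0 (≋-trans (≋-sym xc^k≋1) (*-≋0ˡ (c ℕ.^ k) x≋0))
      ... | no x≉0 = begin
        sumTo p (λ c → [ x ℕ.* c ℕ.^ k ≋? 1 ] * e c)   ≈⟨ sum-cong p (λ c → *-congʳ ([]-cong (x ℕ.* c ℕ.^ k ≋? 1) (c ≋? x) a*b^k≋1⇒b≋a (≋⇒a*b^k≋1 x≉0))) ⟩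
        sumTo p (λ c → [ c ≋? x ] * e c)               ≈⟨ sum-indicator x e-resp ⟩
        e x                                            ≈⟨ *-identityˡ _ ⟨
        1# * e x                                       ≈⟨ *-congʳ (ε-unit x≉0) ⟨
        ε x * e x                                      ∎

      E : ℕ → ℕ → ℕ → ℕ → Carrier
      E a b c d = e a * e b * e c * e d * φ b

      C≈Σ[Kc^k≋1] : C n α ≈ sumTo p (λ a → sumTo p (λ b → sumTo p (λ c → sumTo p (λ d →
                            E a b c d * (fromℕ q * [ K a b d ℕ.* c ℕ.^ k ≋? 1 ])))))
      C≈Σ[Kc^k≋1] = begin
        C n α
          ≈⟨ sum-cong q (λ j → sum-product₄ p _ _ _ _ _) ⟩
        sumTo q (λ j → sumTo p (λ a → sumTo p (λ b → sumTo p (λ c → sumTo p (λ d → summand j a b c d)))))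
          ≈⟨ sum-swap q p _ ⟩
        sumTo p (λ a → sumTo q (λ j → sumTo p (λ b → sumTo p (λ c → sumTo p (λ d → summand j a b c d)))))
          ≈⟨ sum-cong p (λ a → trans (sum-swap q p _) (sum-cong p (λ b → trans (sum-swap q p _) (sum-cong p (λ c → sum-swap q p _))))) ⟩
        sumTo p (λ a → sumTo p (λ b → sumTo p (λ c → sumTo p (λ d → sumTo q (λ j → summand j a b c d)))))
          ≈⟨ sum-cong p (λ a → sum-cong p (λ b → sum-cong p (λ c → sum-cong p (λ d → sum-over-j a b c d)))) ⟩
        sumTo p (λ a → sumTo p (λ b → sumTo p (λ c → sumTo p (λ d → E a b c d * (fromℕ q * [ K a b d ℕ.* c ℕ.^ k ≋? 1 ])))))
          ∎
        where
        sum-over-j : ∀ a b c d → sumTo q (λ j → summand j a b c d) ≈ E a b c d * (fromℕ q * [ K a b d ℕ.* c ℕ.^ k ≋? 1 ])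
        sum-over-j a b c d = begin
          sumTo q (λ j → summand j a b c d)                            ≈⟨ sum-cong q (λ j → summand≈ j a b c d) ⟩
          sumTo q (λ j → E a b c d * char j (K a b d ℕ.* c ℕ.^ k))     ≈⟨ sum-distribˡ q (E a b c d) _ ⟨
          E a b c d * sumTo q (λ j → char j (K a b d ℕ.* c ℕ.^ k))     ≈⟨ *-congˡ (orthogonality (K a b d ℕ.* c ℕ.^ k)) ⟩
          E a b c d * (fromℕ q * [ K a b d ℕ.* c ℕ.^ k ≋? 1 ])         ∎

      F : ℕ → ℕ → ℕ → Carrier
      F a b d = (e a * e b * e d * φ b) * (ε (K a b d) * e (K a b d))

      Σ[Kc^k≋1]≈ΣF : sumTo p (λ a → sumTo p (λ b → sumTo p (λ c → sumTo p (λ d →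
                      E a b c d * (fromℕ q * [ K a b d ℕ.* c ℕ.^ k ≋? 1 ])))))
                   ≈ fromℕ q * sumTo p (λ a → sumTo p (λ b → sumTo p (λ d → F a b d)))
      Σ[Kc^k≋1]≈ΣF = begin
        sumTo p (λ a → sumTo p (λ b → sumTo p (λ c → sumTo p (λ d → E a b c d * (fromℕ q * [ K a b d ℕ.* c ℕ.^ k ≋? 1 ])))))
          ≈⟨ sum-cong p (λ a → sum-cong p (λ b → trans (sum-swap p p _) (sum-cong p (λ d → collapse-c a b d)))) ⟩
        sumTo p (λ a → sumTo p (λ b → sumTo p (λ d → fromℕ q * F a b d)))
          ≈⟨ sum-cong p (λ a → trans (sum-distribˡ p (fromℕ q) _) (sum-cong p (λ b → sum-distribˡ p (fromℕ q) _))) ⟨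
        sumTo p (λ a → fromℕ q * sumTo p (λ b → sumTo p (λ d → F a b d)))
          ≈⟨ sum-distribˡ p (fromℕ q) _ ⟨
        fromℕ q * sumTo p (λ a → sumTo p (λ b → sumTo p (λ d → F a b d)))
          ∎
        where
        collapse-c : ∀ a b d → sumTo p (λ c → E a b c d * (fromℕ q * [ K a b d ℕ.* c ℕ.^ k ≋? 1 ])) ≈ fromℕ q * F a b d
        collapse-c a b d = begin
          sumTo p (λ c → E a b c d * (fromℕ q * [ K a b d ℕ.* c ℕ.^ k ≋? 1 ]))
            ≈⟨ sum-cong p (λ c → solve 7 (λ ea eb ec ed φb Q I → (ea :* eb :* ec :* ed :* φb) :* (Q :* I) := (Q :* (ea :* eb :* ed :* φb)) :* (I :* ec)) refl
                 (e a) (e b) (e c) (e d) (φ b) (fromℕ q) [ K a b d ℕ.* c ℕ.^ k ≋? 1 ]) ⟩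
          sumTo p (λ c → (fromℕ q * (e a * e b * e d * φ b)) * ([ K a b d ℕ.* c ℕ.^ k ≋? 1 ] * e c))
            ≈⟨ sum-distribˡ p _ _ ⟨
          (fromℕ q * (e a * e b * e d * φ b)) * sumTo p (λ c → [ K a b d ℕ.* c ℕ.^ k ≋? 1 ] * e c)
            ≈⟨ *-congˡ (sum-over-c (K a b d)) ⟩
          (fromℕ q * (e a * e b * e d * φ b)) * (ε (K a b d) * e (K a b d))
            ≈⟨ *-assoc _ _ _ ⟩
          fromℕ q * F a b d
            ∎

      U : ℕ → ℕ → ℕ → Carrier
      U t β d = (φ β * ε t) * e (d ℕ.* L t β)

      φβ*ε[dM]≈φβ*ε[t] : ∀ {d} → ¬ d ≋ 0 → ∀ t β → φ β * ε (d ℕ.* M t β) ≈ φ β * ε t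
      φβ*ε[dM]≈φβ*ε[t] {d} d≉0 t β with β ≋? 0 | t ≋? 0
      ... | yes β≋0 | _       = trans (*-congʳ (char-≋0 h β≋0)) (trans (zeroˡ _) (sym (trans (*-congʳ (char-≋0 h β≋0)) (zeroˡ _))))
      ... | no _    | yes t≋0 = *-congˡ (trans (ε-≋0 (*-≋0ʳ d (M≋0 β t≋0))) (sym (ε-≋0 t≋0)))
      ... | no β≉0  | no t≉0  = *-congˡ (trans (ε-unit (*-≉0 d≉0 (M≉0 t≉0 β≉0))) (sym (ε-unit t≉0)))

      e[dt]e[dβ]e[d]e[dM]≈e[dL] : ∀ d t β → e (d ℕ.* t) * e (d ℕ.* β) * e d * e (d ℕ.* M t β) ≈ e (d ℕ.* L t β)
      e[dt]e[dβ]e[d]e[dM]≈e[dL] d t β = begin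
        e (d ℕ.* t) * e (d ℕ.* β) * e d * e (d ℕ.* M t β)          ≈⟨ *-congʳ (*-congʳ (e-+ (d ℕ.* t) (d ℕ.* β))) ⟨
        e (d ℕ.* t ℕ.+ d ℕ.* β) * e d * e (d ℕ.* M t β)            ≈⟨ *-congʳ (e-+ (d ℕ.* t ℕ.+ d ℕ.* β) d) ⟨
        e (d ℕ.* t ℕ.+ d ℕ.* β ℕ.+ d) * e (d ℕ.* M t β)            ≈⟨ e-+ (d ℕ.* t ℕ.+ d ℕ.* β ℕ.+ d) (d ℕ.* M t β) ⟨
        e (d ℕ.* t ℕ.+ d ℕ.* β ℕ.+ d ℕ.+ d ℕ.* M t β)              ≡⟨ ≡.cong e (d*L≡ d t β) ⟨
        e (d ℕ.* L t β)                                            ∎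

      F-scaled : ∀ {d} → ¬ d ≋ 0 → ∀ t β → F (d ℕ.* t) (d ℕ.* β) d ≈ φ d * U t β d
      F-scaled {d} d≉0 t β = begin
        F (d ℕ.* t) (d ℕ.* β) d
          ≈⟨ *-cong (*-congˡ (char-* h d β)) (*-cong (char-resp 0 (K-scaled d≉0 t β)) (e-resp (K-scaled d≉0 t β))) ⟩
        (e (d ℕ.* t) * e (d ℕ.* β) * e d * (φ d * φ β)) * (ε (d ℕ.* M t β) * e (d ℕ.* M t β))
          ≈⟨ solve 7 (λ et eβ ed φd φβ εM eM → (et :* eβ :* ed :* (φd :* φβ)) :* (εM :* eM) := φd :* ((φβ :* εM) :* (et :* eβ :* ed :* eM))) refl
               (e (d ℕ.* t)) (e (d ℕ.* β)) (e d) (φ d) (φ β) (ε (d ℕ.* M t β)) (e (d ℕ.* M t β)) ⟩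
        φ d * ((φ β * ε (d ℕ.* M t β)) * (e (d ℕ.* t) * e (d ℕ.* β) * e d * e (d ℕ.* M t β)))
          ≈⟨ *-congˡ (*-cong (φβ*ε[dM]≈φβ*ε[t] d≉0 t β) (e[dt]e[dβ]e[d]e[dM]≈e[dL] d t β)) ⟩
        φ d * U t β d
          ∎

      -- Substituting a = d t and b = d β turns the additive character into e(d · L t β).
      ΣF[d] : ∀ d → sumTo p (λ a → sumTo p (λ b → F a b d)) ≈ φ d * sumTo p (λ t → sumTo p (λ β → U t β d))
      ΣF[d] d with d ≋? 0
      ... | yes d≋0 = begin
        sumTo p (λ a → sumTo p (λ b → F a b d))                ≈⟨ sum-zero p (λ a _ → sum-zero p (λ b _ → F≋0 a b)) ⟩
        0#                                                    ≈⟨ zeroˡ _ ⟨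
        0# * sumTo p (λ t → sumTo p (λ β → U t β d))          ≈⟨ *-congʳ (char-≋0 h d≋0) ⟨
        φ d * sumTo p (λ t → sumTo p (λ β → U t β d))         ∎
        where
        F≋0 : ∀ a b → F a b d ≈ 0#
        F≋0 a b = trans (*-congˡ (trans (*-congʳ (ε-≋0 (K≋0 a b d≋0))) (zeroˡ _))) (zeroʳ _)
      ... | no d≉0 = begin
        sumTo p (λ a → sumTo p (λ b → F a b d))                          ≈⟨ sum-scale d d≉0 (λ a≋a′ → sum-cong p (λ b → F-resp a≋a′ ≋-refl)) ⟨
        sumTo p (λ t → sumTo p (λ b → F (d ℕ.* t) b d))                  ≈⟨ sum-cong p (λ t → sum-scale d d≉0 (F-resp ≋-refl)) ⟨
        sumTo p (λ t → sumTo p (λ β → F (d ℕ.* t) (d ℕ.* β) d))          ≈⟨ sum-cong p (λ t → sum-cong p (F-scaled d≉0 t)) ⟩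
        sumTo p (λ t → sumTo p (λ β → φ d * U t β d))                    ≈⟨ sum-cong p (λ t → sum-distribˡ p (φ d) _) ⟨
        sumTo p (λ t → φ d * sumTo p (λ β → U t β d))                    ≈⟨ sum-distribˡ p (φ d) _ ⟨
        φ d * sumTo p (λ t → sumTo p (λ β → U t β d))                    ∎
        where
        F-resp : ∀ {a a′ b b′} → a ≋ a′ → b ≋ b′ → F a b d ≈ F a′ b′ d
        F-resp a≋a′ b≋b′ = *-cong (*-cong (*-congʳ (*-cong (e-resp a≋a′) (e-resp b≋b′))) (char-resp h b≋b′))
                                  (*-cong (char-resp 0 (K-≋ d a≋a′ b≋b′)) (e-resp (K-≋ d a≋a′ b≋b′)))

      ΣF≈ : sumTo p (λ a → sumTo p (λ b → sumTo p (λ d → F a b d)))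
            ≈ gauss h * sumTo p (λ t → sumTo p (λ β → ε t * (φ β * φ (L t β))))
      ΣF≈ = begin
        sumTo p (λ a → sumTo p (λ b → sumTo p (λ d → F a b d)))
          ≈⟨ trans (sum-cong p (λ a → sum-swap p p _)) (sum-swap p p _) ⟩
        sumTo p (λ d → sumTo p (λ a → sumTo p (λ b → F a b d)))
          ≈⟨ sum-cong p ΣF[d] ⟩
        sumTo p (λ d → φ d * sumTo p (λ t → sumTo p (λ β → U t β d)))
          ≈⟨ sum-cong p (λ d → trans (sum-distribˡ p (φ d) _) (sum-cong p (λ t → sum-distribˡ p (φ d) _))) ⟩
        sumTo p (λ d → sumTo p (λ t → sumTo p (λ β → φ d * U t β d)))
          ≈⟨ trans (sum-swap p p _) (sum-cong p (λ t → sum-swap p p _)) ⟩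
        sumTo p (λ t → sumTo p (λ β → sumTo p (λ d → φ d * U t β d)))
          ≈⟨ sum-cong p (λ t → sum-cong p (λ β → sum-over-d t β)) ⟩
        sumTo p (λ t → sumTo p (λ β → gauss h * (ε t * (φ β * φ (L t β)))))
          ≈⟨ trans (sum-distribˡ p (gauss h) _) (sum-cong p (λ t → sum-distribˡ p (gauss h) _)) ⟨
        gauss h * sumTo p (λ t → sumTo p (λ β → ε t * (φ β * φ (L t β))))
          ∎
        where
        sum-over-d : ∀ t β → sumTo p (λ d → φ d * U t β d) ≈ gauss h * (ε t * (φ β * φ (L t β)))
        sum-over-d t β = begin
          sumTo p (λ d → φ d * U t β d)                              ≈⟨ sum-cong p (λ d → solve 3 (λ x y z → x :* (y :* z) := y :* (x :* z)) refl (φ d) (φ β * ε t) (e (d ℕ.* L t β))) ⟩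
          sumTo p (λ d → (φ β * ε t) * (φ d * e (d ℕ.* L t β)))      ≈⟨ sum-distribˡ p (φ β * ε t) _ ⟨
          (φ β * ε t) * sumTo p (λ d → φ d * e (d ℕ.* L t β))        ≈⟨ *-congˡ (twisted-gauss (L t β)) ⟩
          (φ β * ε t) * (φ (L t β) * gauss h)                        ≈⟨ solve 4 (λ x y z G → (x :* y) :* (z :* G) := G :* (y :* (x :* z))) refl (φ β) (ε t) (φ (L t β)) (gauss h) ⟩
          gauss h * (ε t * (φ β * φ (L t β)))                        ∎

      -- For β ≠ 0, φ β · φ (L t β) = φ (β · L t β), a quadratic in β; β = 0 contributes φ (t ^ m α) to the full quadratic sum.
      sum-over-β : ∀ t → sumTo p (λ β → φ β * φ (L t β)) ≈ (fromℕ p * [ cond? t ] - 1#) - φ (t ℕ.^ m ℕ.* α)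
      sum-over-β t = begin
        sumTo p (λ β → φ β * φ (L t β))                                  ≈⟨ sum-head q _ ⟩
        φ 0 * φ (L t 0) + sumTo q (λ x → φ (suc x) * φ (L t (suc x)))   ≈⟨ +-cong (trans (*-congʳ (char-≋0 h ≋-refl)) (zeroˡ _)) (sum-cong< q (λ x x<q → units (suc-≉0 (s≤s x<q)))) ⟩
        0# + Σunits                                                      ≈⟨ +-identityˡ Σunits ⟩
        Σunits                                                           ≈⟨ x≈[y+x]-y Σunits (φ (t ℕ.^ m ℕ.* α)) ⟩
        (φ (t ℕ.^ m ℕ.* α) + Σunits) - φ (t ℕ.^ m ℕ.* α)                ≈⟨ +-congʳ (+-congʳ (char-resp h Q[0]≋t^mα)) ⟨
        (φ (Q 0) + Σunits) - φ (t ℕ.^ m ℕ.* α)                          ≈⟨ +-congʳ (sum-head q (λ β → φ (Q β))) ⟨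
        sumTo p (λ β → φ (Q β)) - φ (t ℕ.^ m ℕ.* α)                      ≈⟨ +-congʳ (quadratic-char-sum (suc t) (t ℕ.^ m ℕ.* α)) ⟩
        (fromℕ p * [ cond? t ] - 1#) - φ (t ℕ.^ m ℕ.* α)                 ∎
        where
        Q : ℕ → ℕ
        Q β = β ℕ.* β ℕ.+ suc t ℕ.* β ℕ.+ t ℕ.^ m ℕ.* α
        Σunits : Carrier
        Σunits = sumTo q (λ x → φ (Q (suc x)))
        units : ∀ {β} → ¬ β ≋ 0 → φ β * φ (L t β) ≈ φ (Q β)
        units {β} β≉0 = trans (sym (char-* h β (L t β))) (char-resp h (β*L≋β²+[1+t]β+t^mα t β≉0))
        Q[0]≋t^mα : Q 0 ≋ t ℕ.^ m ℕ.* α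
        Q[0]≋t^mα = ≡⇒≋ (≡.cong (ℕ._+ t ℕ.^ m ℕ.* α) (ℕ.*-zeroʳ (suc t)))
        x≈[y+x]-y : ∀ x y → x ≈ (y + x) - y
        x≈[y+x]-y x y = begin
          x                ≈⟨ +-identityʳ x ⟨
          x + 0#           ≈⟨ +-congˡ (-‿inverseʳ y) ⟨
          x + (y - y)      ≈⟨ +-assoc x y (- y) ⟨
          (x + y) - y      ≈⟨ +-congʳ (+-comm x y) ⟩
          (y + x) - y      ∎

      r : Carrier
      r = sumTo p (λ t → [ cond? t ])

      δ-cong : ∀ i j → i ℕ.% q ≡ j ℕ.% q → δ i ≈ δ j
      δ-cong i j i≡j = reflexive (≡.cong (λ x → if x ≡ᵇ 0 then 1# else 0#) i≡j)

      sum-φ[t^m] : sumTo p (λ t → φ (t ℕ.^ m)) ≈ fromℕ q * δ (n ℕ.* h)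
      sum-φ[t^m] = begin
        sumTo p (λ t → φ (t ℕ.^ m))     ≈⟨ sum-cong p (λ t → char-^ m h t m≢0) ⟨
        sumTo p (char (m ℕ.* h))        ≈⟨ sum-char (m ℕ.* h) ⟩
        fromℕ q * δ (m ℕ.* h)           ≈⟨ *-congˡ (δ-cong (m ℕ.* h) (n ℕ.* h) m*h%q≡n*h%q) ⟩
        fromℕ q * δ (n ℕ.* h)           ∎

      sum-over-t : sumTo p (λ t → ε t * ((fromℕ p * [ cond? t ] - 1#) - φ (t ℕ.^ m ℕ.* α)))
                   ≈ (fromℕ p * r - fromℕ q) - φ α * (fromℕ q * δ (n ℕ.* h))
      sum-over-t = begin
        sumTo p (λ t → ε t * ((fromℕ p * [ cond? t ] - 1#) - φ (t ℕ.^ m ℕ.* α)))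
          ≈⟨ sum-cong p split ⟩
        sumTo p (λ t → (fromℕ p * [ cond? t ] - ε t) - φ α * φ (t ℕ.^ m))
          ≈⟨ trans (sum-+ p _ _) (+-cong (sum-+ p _ _) (sum-neg p _)) ⟩
        (sumTo p (λ t → fromℕ p * [ cond? t ]) + sumTo p (λ t → - ε t)) - sumTo p (λ t → φ α * φ (t ℕ.^ m))
          ≈⟨ +-cong (+-cong (sym (sum-distribˡ p _ _)) (trans (sum-neg p ε) (-‿cong Σε)))
                    (-‿cong (trans (sym (sum-distribˡ p _ _)) (*-congˡ sum-φ[t^m]))) ⟩
        (fromℕ p * r - fromℕ q) - φ α * (fromℕ q * δ (n ℕ.* h))
          ∎
        where
        Σε : sumTo p ε ≈ fromℕ q
        Σε = trans (sum-char 0) (trans (*-congˡ (δ-trivial 0 ≡.refl)) (*-identityʳ _))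
        split : ∀ t → ε t * ((fromℕ p * [ cond? t ] - 1#) - φ (t ℕ.^ m ℕ.* α))
                      ≈ (fromℕ p * [ cond? t ] - ε t) - φ α * φ (t ℕ.^ m)
        split t with t ≋? 0
        ... | yes t≋0 = begin
          ε t * ((fromℕ p * [ cond? t ] - 1#) - φ (t ℕ.^ m ℕ.* α))   ≈⟨ trans (*-congʳ (ε-≋0 t≋0)) (zeroˡ _) ⟩
          0#                                                          ≈⟨ -‿inverseʳ 0# ⟨
          0# - 0#                                                     ≈⟨ +-congʳ (-‿inverseʳ 0#) ⟨
          (0# - 0#) - 0#                                              ≈⟨ +-cong (+-cong p[cond]≈0 (-‿cong (ε-≋0 t≋0))) (-‿cong φα*φ[t^m]≈0) ⟨
          (fromℕ p * [ cond? t ] - ε t) - φ α * φ (t ℕ.^ m)           ∎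
          where
          p[cond]≈0 : fromℕ p * [ cond? t ] ≈ 0#
          p[cond]≈0 = trans (*-congˡ ([]-no (cond? t) (¬cond[0] t≋0))) (zeroʳ _)
          φα*φ[t^m]≈0 : φ α * φ (t ℕ.^ m) ≈ 0#
          φα*φ[t^m]≈0 = trans (*-congˡ (char-≋0 h (^-≋0 m m≢0 t≋0))) (zeroʳ _)
        ... | no t≉0 = begin
          ε t * ((fromℕ p * [ cond? t ] - 1#) - φ (t ℕ.^ m ℕ.* α))   ≈⟨ trans (*-congʳ (ε-unit t≉0)) (*-identityˡ _) ⟩
          (fromℕ p * [ cond? t ] - 1#) - φ (t ℕ.^ m ℕ.* α)           ≈⟨ +-cong (+-congˡ (-‿cong (sym (ε-unit t≉0)))) (-‿cong (trans (char-* h (t ℕ.^ m) α) (*-comm _ _))) ⟩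
          (fromℕ p * [ cond? t ] - ε t) - φ α * φ (t ℕ.^ m)           ∎

      C≈ : C n α ≈ fromℕ q * (gauss h * ((fromℕ p * r - fromℕ q) - φ α * (fromℕ q * δ (n ℕ.* h))))
      C≈ = begin
        C n α
          ≈⟨ trans C≈Σ[Kc^k≋1] Σ[Kc^k≋1]≈ΣF ⟩
        fromℕ q * sumTo p (λ a → sumTo p (λ b → sumTo p (λ d → F a b d)))
          ≈⟨ *-congˡ ΣF≈ ⟩
        fromℕ q * (gauss h * sumTo p (λ t → sumTo p (λ β → ε t * (φ β * φ (L t β)))))
          ≈⟨ *-congˡ (*-congˡ (sum-cong p (λ t → trans (sym (sum-distribˡ p (ε t) _)) (*-congˡ (sum-over-β t))))) ⟩
        fromℕ q * (gauss h * sumTo p (λ t → ε t * ((fromℕ p * [ cond? t ] - 1#) - φ (t ℕ.^ m ℕ.* α))))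
          ≈⟨ *-congˡ (*-congˡ sum-over-t) ⟩
        fromℕ q * (gauss h * ((fromℕ p * r - fromℕ q) - φ α * (fromℕ q * δ (n ℕ.* h))))
          ∎

      LHS≈ : LHS n α ≈ fromℕ q * (gauss h * (fromℕ p * r))
      LHS≈ = begin
        C n α + fromℕ (q ℕ.* q) * gauss h * (1# + φ α * δ (n ℕ.* h))
          ≈⟨ +-cong C≈ (*-congʳ (*-congʳ (fromℕ-* q q))) ⟩
        fromℕ q * (gauss h * ((fromℕ p * r - fromℕ q) - φ α * (fromℕ q * δ (n ℕ.* h))))
          + fromℕ q * fromℕ q * gauss h * (1# + φ α * δ (n ℕ.* h))
          ≈⟨ correction-cancels (fromℕ q) (gauss h) (fromℕ p * r) (φ α) (δ (n ℕ.* h)) ⟩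
        fromℕ q * (gauss h * (fromℕ p * r))
          ∎
        where
        open import Algebra.Properties.AbelianGroup +-abelianGroup using (⁻¹-∙-comm)
        correction-cancels : ∀ Q G X F D → Q * (G * ((X - Q) - F * (Q * D))) + Q * Q * G * (1# + F * D) ≈ Q * (G * X)
        correction-cancels Q G X F D = begin
          Q * (G * ((X - Q) - F * (Q * D))) + Q * Q * G * (1# + F * D)
            ≈⟨ +-cong (*-congˡ (*-congˡ (trans (+-assoc X (- Q) _) (+-congˡ (⁻¹-∙-comm Q (F * (Q * D)))))))
                      (solve 5 (λ Q G F D o → Q :* Q :* G :* (o :+ F :* D) := Q :* (G :* (Q :* o :+ F :* (Q :* D)))) refl Q G F D 1#) ⟩
          Q * (G * (X - Y)) + Q * (G * (Q * 1# + F * (Q * D)))  ≈⟨ +-congˡ (*-congˡ (*-congˡ (+-congʳ (*-identityʳ Q)))) ⟩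
          Q * (G * (X - Y)) + Q * (G * Y)                       ≈⟨ distribˡ Q _ _ ⟨
          Q * (G * (X - Y) + G * Y)                             ≈⟨ *-congˡ (distribˡ G _ _) ⟨
          Q * (G * ((X - Y) + Y))                               ≈⟨ *-congˡ (*-congˡ (trans (+-assoc X (- Y) Y) (trans (+-congˡ (-‿inverseˡ Y)) (+-identityʳ X)))) ⟩
          Q * (G * X)                                           ∎
          where
          Y = Q + F * (Q * D)

      r≈#roots : r ≈ fromℕ (countRoots p (fpoly n α))
      r≈#roots = begin
        sumTo p (λ t → [ cond? t ])                  ≈⟨ sum-reindex σ σ [cond]-resp σ-resp σ-resp σ-involutive σ-involutive ⟨
        sumTo p (λ y → [ cond? (σ y) ])              ≈⟨ sum-cong p (λ y → []-cong (cond? (σ y)) (p ∣? ℤ.∣ fpoly n α y ∣)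
                                                          (Equivalence.from (fpoly-root⇔cond[σ] y)) (Equivalence.to (fpoly-root⇔cond[σ] y))) ⟩
        sumTo p (λ y → [ p ∣? ℤ.∣ fpoly n α y ∣ ])    ≈⟨ count-as-sum (λ y → p ∣? ℤ.∣ fpoly n α y ∣) p (λ y → y) ⟨
        fromℕ (countRoots p (fpoly n α))             ∎
        where
        [cond]-resp : (λ t → [ cond? t ]) Preserves _≋_ ⟶ _≈_
        [cond]-resp {t} {t′} t≋t′ = []-cong (cond? t) (cond? t′) (cond-resp t≋t′) (cond-resp (≋-sym t≋t′))

      LHS≈#roots : LHS n α ≈ fromℕ (countRoots p (fpoly n α) ℕ.* p ℕ.* q) * gauss h
      LHS≈#roots = begin
        LHS n α                                     ≈⟨ LHS≈ ⟩
        fromℕ q * (gauss h * (fromℕ p * r))          ≈⟨ *-congˡ (*-congˡ (*-congˡ r≈#roots)) ⟩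
        fromℕ q * (gauss h * (fromℕ p * fromℕ N))    ≈⟨ solve 4 (λ Q G P N → Q :* (G :* (P :* N)) := N :* P :* Q :* G) refl (fromℕ q) (gauss h) (fromℕ p) (fromℕ N) ⟩
        fromℕ N * fromℕ p * fromℕ q * gauss h        ≈⟨ *-congʳ (trans (fromℕ-* (N ℕ.* p) q) (*-congʳ (fromℕ-* N p))) ⟨
        fromℕ (N ℕ.* p ℕ.* q) * gauss h              ∎
        where
        N = countRoots p (fpoly n α)

proposition3p1 :
    ∀ {c ℓ : Level} (R : CommutativeRing c ℓ) →
    let open CommutativeRing R
        open Chars R in
    -- R is an integral domain
    (∀ a b → a * b ≈ 0# → a ≈ 0# ⊎ b ≈ 0#) →
    ∀ (n p g : ℕ) (ω ζ : Carrier) →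
    1 ≤ n → Prime p → ¬ (2 ∣ p) → ¬ (p ∣ (3 ℕ.* n) ℕ.* (3 ℕ.* n ∸ 2)) →
    -- g is a primitive root mod p
    ¬ (p ∣ g) → (∀ k → 0 < k → k < p ∸ 1 → ¬ (p ∣ (g ℕ.^ k ∸ 1))) →
    -- ω is a primitive (p-1)-th root of unity in R
    pow p g ω ζ ω (p ∸ 1) ≈ 1# →
    (∀ k → 0 < k → k < p ∸ 1 → ¬ (pow p g ω ζ ω k ≈ 1#)) →
    -- ζ = ζ_p is a primitive p-th root of unity in R
    pow p g ω ζ ζ p ≈ 1# → ¬ (ζ ≈ 1#) →
    -- x ∈ F_p^× and α ≡ (-1)^n (3n-2)^{3n-2} / ((3n)^{3n} x)  (mod p)
    ∀ (x α : ℕ) → ¬ (p ∣ x) →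
    (+ p) ℤDiv.∣ (+ (α ℕ.* (3 ℕ.* n) ℕ.^ (3 ℕ.* n) ℕ.* x)
                  ℤ.- ((ℤ.- + 1) ℤ.^ n) ℤ.* + ((3 ℕ.* n ∸ 2) ℕ.^ (3 ℕ.* n ∸ 2))) →
    (countRoots p (fpoly n α) ≡ 0 → LHS p g ω ζ n α ≈ 0#)
    × (LHS p g ω ζ n α ≈
         fromℕ p g ω ζ (countRoots p (fpoly n α) ℕ.* p ℕ.* (p ∸ 1)) * gauss p g ω ζ (half p g ω ζ))
proposition3p1 R domain n zero          g ω ζ 1≤n p-prime = ⊥-elim (NonTrivial.nonTrivial (prime⇒nonTrivial p-prime))
proposition3p1 R domain n (suc zero)    g ω ζ 1≤n p-prime = ⊥-elim (NonTrivial.nonTrivial (prime⇒nonTrivial p-prime))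
proposition3p1 R domain n (suc (suc k)) g ω ζ 1≤n p-prime odd p∤3n[3n-2] p∤g g-primitive ω^q≈1 ω-primitive ζ^p≈1 _ x α _ congruence =
  (λ no-roots → trans LHS≈#roots (trans (*-congʳ (reflexive (≡.cong (λ r → fromℕ (r ℕ.* p ℕ.* q)) no-roots))) (zeroˡ _)))
  , LHS≈#roots
  where
  open CommutativeRing R
  open Characters R domain k p-prime odd g p∤g g-primitive ω ζ ω^q≈1 ω-primitive ζ^p≈1
  open MainIdentity n 1≤n α (congruence⇒p∤α n x α p∤3n[3n-2] congruence)
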